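{- Let $n$ be an odd positive integer and let $\vec P_n$ be an alternating path on $n$ vertices. Then $\operatorname{th}(\vec P_n)=\frac{n-1}{2}+\left\lceil\sqrt{n+1}-\frac12\right\rceil$.
   Context: An alternating path on $n$ vertices is an orientation of the path $P_n$ (each edge replaced by exactly one of its two arcs) in which every vertex is either a source (in-degree $0$) or a sink (out-degree $0$). Zero forcing on a digraph: vertices are blue or white; a blue vertex $u$ with exactly one white out-neighbor $w$ may force $w$ ($u\to w$), turning it blue. A set $\mathcal F$ of forces is a set of forces of $B\subseteq V$ if, starting with exactly $B$ blue, the forces in $\mathcal F$ can be validly performed in some order after which no further force is possible. Put $\mathcal F^{[0]}=B$ and $\mathcal F^{[t+1]}=\mathcal F^{[t]}\cup\{w\notin\mathcal F^{[t]}:(u\to w)\in\mathcal F,\ u\in\mathcal F^{[t]},\ w$ the only out-neighbor of $u$ outside $\mathcal F^{[t]}\}$; $\operatorname{pt}(\Gamma;\mathcal F)$ is the least $t$ with $\mathcal F^{[t]}=V$ ($\infty$ if none); $\operatorname{pt}(\Gamma;B)=\min_{\mathcal F}\operatorname{pt}(\Gamma;\mathcal F)$. The throttling number is $\operatorname{th}(\Gamma)=\min_{B\subseteq V}(|B|+\operatorname{pt}(\Gamma;B))$. -}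

module Defs where

open import Data.Nat using (ℕ; zero; suc; _+_; _*_; _∸_; _≤_; _<_)
open import Data.Fin using (Fin; toℕ)
open import Data.Fin.Subset using (Subset; _∈_; _∉_; ∣_∣; inside)
open import Data.Vec using (_[_]≔_)
open import Data.Bool using (Bool; true; false)
open import Data.List using (List; []; _∷_)
open import Data.List.Membership.Propositional using () renaming (_∈_ to _∈ₗ_)
open import Data.Product using (Σ; ∃; _×_; _,_)
open import Data.Sum using (_⊎_)
open import Relation.Binary.PropositionalEquality using (_≡_)
open import Relation.Nullary using (¬_)

Digraph : ℕ → Set
Digraph n = Fin n → Fin n → Bool

PathAdj : {n : ℕ} → Fin n → Fin n → Set
PathAdj u v = (suc (toℕ u) ≡ toℕ v) ⊎ (suc (toℕ v) ≡ toℕ u)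

IsOrientationOfPath : {n : ℕ} → Digraph n → Set
IsOrientationOfPath {n} Γ =
  ((u v : Fin n) → Γ u v ≡ true → PathAdj u v) ×
  ((u v : Fin n) → suc (toℕ u) ≡ toℕ v →
     (Γ u v ≡ true × Γ v u ≡ false) ⊎ (Γ u v ≡ false × Γ v u ≡ true))

IsAlternating : {n : ℕ} → Digraph n → Set
IsAlternating {n} Γ =
  (v : Fin n) → ((u : Fin n) → Γ u v ≡ false) ⊎ ((w : Fin n) → Γ v w ≡ false)

ValidForce : {n : ℕ} → Digraph n → Subset n → Fin n → Fin n → Set
ValidForce {n} Γ S u w =
  u ∈ S × w ∉ S × Γ u w ≡ true × ((x : Fin n) → Γ u x ≡ true → x ∉ S → x ≡ w)

Stalled : {n : ℕ} → Digraph n → Subset n → Set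
Stalled {n} Γ S = ¬ (Σ (Fin n) λ u → Σ (Fin n) λ w → ValidForce Γ S u w)

Force : ℕ → Set
Force n = Fin n × Fin n

data Run {n : ℕ} (Γ : Digraph n) : Subset n → List (Force n) → Set where
  done : ∀ {S} → Stalled Γ S → Run Γ S []
  step : ∀ {S u w L} → ValidForce Γ S u w → Run Γ (S [ w ]≔ inside) L →
         Run Γ S ((u , w) ∷ L)

-- A set of forces F of B: the set of forces occurring in some run from B.
-- We represent F by such a list L (the set is {f : f ∈ L}).
IsForceSetOf : {n : ℕ} → Digraph n → Subset n → List (Force n) → Set
IsForceSetOf Γ B L = Run Γ B L

InStage : {n : ℕ} → Digraph n → Subset n → List (Force n) → ℕ → Fin n → Set
InStage Γ B F zero v = v ∈ B
InStage {n} Γ B F (suc t) v =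
  InStage Γ B F t v ⊎
  (¬ InStage Γ B F t v ×
   Σ (Fin n) λ u → ((u , v) ∈ₗ F) × InStage Γ B F t u × Γ u v ≡ true ×
     ((x : Fin n) → Γ u x ≡ true → ¬ InStage Γ B F t x → x ≡ v))

StageFull : {n : ℕ} → Digraph n → Subset n → List (Force n) → ℕ → Set
StageFull {n} Γ B F t = (v : Fin n) → InStage Γ B F t v

Completes : {n : ℕ} → Digraph n → Subset n → List (Force n) → ℕ → Set
Completes Γ B F t = IsForceSetOf Γ B F × StageFull Γ B F t

-- th(Γ) = m, where th(Γ) = min_B (|B| + min_F pt(Γ;F))
--       = min { |B| + t : F a set of forces of B, F^[t] = V }.
IsThrottlingNumber : {n : ℕ} → Digraph n → ℕ → Set
IsThrottlingNumber {n} Γ m =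
  (Σ (Subset n) λ B → Σ (List (Force n)) λ F → Σ ℕ λ t →
     Completes Γ B F t × ∣ B ∣ + t ≡ m) ×
  ((B : Subset n) (F : List (Force n)) (t : ℕ) → Completes Γ B F t → m ≤ ∣ B ∣ + t)

-- k = ⌈ √(n+1) − 1/2 ⌉, i.e. k − 1 < √(n+1) − 1/2 ≤ k, i.e.
-- (2k−1)² < 4(n+1) ≤ (2k+1)²  (for k = 0 the left condition is vacuous,
-- matching (2·0 ∸ 1)² = 1 < 4(n+1)).
IsCeilSqrtTerm : ℕ → ℕ → Set
IsCeilSqrtTerm n k =
  ((2 * k ∸ 1) * (2 * k ∸ 1) < 4 * (n + 1)) × (4 * (n + 1) ≤ (2 * k + 1) * (2 * k + 1))

module Submission where

-- Sinks and sources alternate along the path; number the sinks 0, 1, … from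
-- left to right.  Sources have no in-arcs, so they all start blue, and a sink
-- is forced by a neighbouring source only once the source's other sink is
-- blue.  Hence after t rounds every sink lies within distance t of an
-- initially blue sink, or of a virtual sink just off an end of the path when
-- the path starts with a source.  Counting gives |B| = m + b with
-- m + 1 ≤ (2t + 1)b, and 4xy ≤ (x + y)² turns this into k ≤ b + t (lower
-- bound).  Conversely, writing k = b + t with m + 1 ≤ (2t + 1)b, a blue set
-- made of the sources and b evenly spaced sinks, with every other sink forced
-- from the side of a centre within distance t, completes in t rounds.

open import Defs
open import Data.Nat
open import Data.Nat.Properties
open import Data.Nat.DivMod using (_/_; _%_; m≡m%n+[m/n]*n; m*n/n≡m)
open import Data.Nat.Induction using (<-rec)
open import Data.Nat.Tactic.RingSolver using (solve-∀)
open import Data.Bool using (Bool; true; false; not; _∨_)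
import Data.Bool.Properties as BoolP
import Data.Fin as Fin
open import Data.Fin using (Fin; toℕ; fromℕ<) renaming (zero to fzero; suc to fsuc)
open import Data.Fin.Properties using (toℕ-injective; toℕ-fromℕ<; toℕ<n) renaming (any? to anyFin?; all? to allFin?)
open import Data.Fin.Subset using (Subset; _∈_; _∉_; ∣_∣; inside)
import Data.Fin.Subset.Properties as SubsetP
open import Data.Vec using ([]; _∷_; tabulate; _[_]≔_)
open import Data.Vec.Base using (here; there)
open import Data.Vec.Properties using (lookup∘tabulate; []=⇒lookup; lookup⇒[]=; lookup∘update; lookup∘update′)
open import Data.List using (List; []; _∷_; _++_; applyUpTo; length)
open import Data.List.Properties using (length-applyUpTo)
open import Data.List.Membership.Propositional using (find; lose) renaming (_∈_ to _∈ₗ_)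
open import Data.List.Membership.Propositional.Properties using (∈-++⁺ˡ; ∈-++⁺ʳ; ∈-applyUpTo⁺; ∈-applyUpTo⁻)
open import Data.List.Membership.DecPropositional _≟_ using (_∈?_)
import Data.List.Membership.DecPropositional as DecMembership
open import Data.List.Relation.Unary.Any using (any?; here; there)
open import Data.Product using (Σ; ∃; _×_; _,_; proj₁; proj₂)
open import Data.Product.Properties using (≡-dec)
open import Data.Sum using (_⊎_; inj₁; inj₂; [_,_]′)
open import Data.Empty using (⊥; ⊥-elim)
open import Function using (_∘_)
open import Relation.Nullary using (¬_; Dec; yes; no; does)
open import Relation.Nullary.Decidable using (_⊎-dec_; _×-dec_; _→-dec_; ¬?; map′; dec-true; dec-false)
open import Relation.Binary.PropositionalEquality hiding ([_])
open import Relation.Binary.Definitions using (tri<; tri≈; tri>)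

even-or-odd : ∀ k → ∃ λ j → k ≡ j + j ⊎ k ≡ suc (j + j)
even-or-odd zero = 0 , inj₁ refl
even-or-odd (suc k) with even-or-odd k
... | j , inj₁ refl = j , inj₂ refl
... | j , inj₂ refl = suc j , inj₁ (cong suc (sym (+-suc j j)))

-- The arithmetic–geometric mean inequality 4xy ≤ (x + y)², first for x ≤ y,
-- where (x + y)² = 4xy + (y − x)².
amgm-ordered : ∀ {x y} → x ≤ y → 4 * x * y ≤ (x + y) * (x + y)
amgm-ordered {x} x≤y with d , refl ← m≤n⇒∃[o]m+o≡n x≤y =
  subst (4 * x * (x + d) ≤_) (sym (square x d)) (m≤m+n _ (d * d))
  where
  square : ∀ x d → (x + (x + d)) * (x + (x + d)) ≡ 4 * x * (x + d) + d * d
  square = solve-∀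

amgm : ∀ x y → 4 * x * y ≤ (x + y) * (x + y)
amgm x y with ≤-total x y
... | inj₁ x≤y = amgm-ordered x≤y
... | inj₂ y≤x = subst₂ _≤_ (swap x y) (cong (λ s → s * s) (+-comm y x)) (amgm-ordered y≤x)
  where
  swap : ∀ x y → 4 * y * x ≡ 4 * x * y
  swap = solve-∀

-- Lower half of the arithmetic: if N items are covered by b balls of size
-- 2t + 1 and (2k − 1)² < 8N, then k ≤ b + t, since otherwise
-- 8N ≤ 4(2b)(2t + 1) ≤ (2b + 2t + 1)² ≤ (2k − 1)².
budget-lower : ∀ N k b t → (2 * k ∸ 1) * (2 * k ∸ 1) < 8 * N → N ≤ (2 * t + 1) * b → k ≤ b + t
budget-lower N k b t small covered with k ≤? b + t
... | yes k≤b+t = k≤b+t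
... | no k≰b+t = ⊥-elim (<⇒≱ small large)
  where
  open ≤-Reasoning
  double-suc : ∀ b t → 2 * suc (b + t) ≡ suc (2 * b + (2 * t + 1))
  double-suc = solve-∀
  side : 2 * b + (2 * t + 1) ≤ 2 * k ∸ 1
  side = subst (λ s → s ∸ 1 ≤ 2 * k ∸ 1) (double-suc b t) (∸-monoˡ-≤ 1 (*-monoʳ-≤ 2 (≰⇒> k≰b+t)))
  regroup : ∀ b t → 8 * ((2 * t + 1) * b) ≡ 4 * (2 * b) * (2 * t + 1)
  regroup = solve-∀
  large : 8 * N ≤ (2 * k ∸ 1) * (2 * k ∸ 1)
  large = begin
    8 * N                                          ≤⟨ *-monoʳ-≤ 8 covered ⟩
    8 * ((2 * t + 1) * b)                          ≡⟨ regroup b t ⟩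
    4 * (2 * b) * (2 * t + 1)                      ≤⟨ amgm (2 * b) (2 * t + 1) ⟩
    (2 * b + (2 * t + 1)) * (2 * b + (2 * t + 1))  ≤⟨ *-mono-≤ side side ⟩
    (2 * k ∸ 1) * (2 * k ∸ 1)                      ∎

eighth : ∀ a c → 8 * a ≤ 8 * c + 1 → a ≤ c
eighth a c h = s≤s⁻¹ (*-cancelˡ-< 8 a (suc c) (begin-strict
    8 * a       ≤⟨ h ⟩
    8 * c + 1   <⟨ m<m+n (8 * c + 1) {7} (s≤s z≤n) ⟩
    8 * c + 1 + 7 ≡⟨ eight-suc c ⟩
    8 * suc c   ∎))
  where
  open ≤-Reasoning
  eight-suc : ∀ c → 8 * c + 1 + 7 ≡ 8 * suc c
  eight-suc = solve-∀

-- Upper half: if 8(N + 1) ≤ (2k + 1)², then k splits as b + t with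
-- N + 1 ≤ (2t + 1)b  (take b = ⌈k/2⌉, t = ⌊k/2⌋).
budget-upper : ∀ N k → 8 * suc N ≤ (2 * k + 1) * (2 * k + 1) →
               Σ ℕ λ b → Σ ℕ λ t → b + t ≡ k × suc N ≤ (2 * t + 1) * b
budget-upper N k h with even-or-odd k
... | j , inj₁ refl = j , j , refl , eighth (suc N) ((2 * j + 1) * j) (subst (8 * suc N ≤_) (even j) h)
  where
  even : ∀ j → (2 * (j + j) + 1) * (2 * (j + j) + 1) ≡ 8 * ((2 * j + 1) * j) + 1
  even = solve-∀
... | j , inj₂ refl = suc j , j , refl , eighth (suc N) ((2 * j + 1) * suc j) (subst (8 * suc N ≤_) (odd j) h)
  where
  odd : ∀ j → (2 * suc (j + j) + 1) * (2 * suc (j + j) + 1) ≡ 8 * ((2 * j + 1) * suc j) + 1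
  odd = solve-∀

positive-factor : ∀ {N D b} → suc N ≤ D * b → 1 ≤ b
positive-factor {N} {D} {zero} le with () ← subst (suc N ≤_) (*-zeroʳ D) le
positive-factor {b = suc _} _ = s≤s z≤n

block-of : ∀ D R x → x < D * R → ∃ λ r → r < R × D * r ≤ x × x < D * r + D
block-of D zero x x<D*0 with () ← subst (x <_) (*-zeroʳ D) x<D*0
block-of D (suc R) x x<D*R+D with x <? D * R
... | yes x<D*R with r , r<R , lower , upper ← block-of D R x x<D*R = r , m<n⇒m<1+n r<R , lower , upper
... | no x≮D*R = R , ≤-refl , ≮⇒≥ x≮D*R , subst (x <_) (trans (*-suc D R) (+-comm D (D * R))) x<D*R+D

below-cut : ∀ {i m t} → i < m ∸ t → i + t < m
below-cut {i} {m} {t} i< with t ≤? m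
... | yes t≤m = ≤-trans (+-monoˡ-≤ t i<) (≤-reflexive (m∸n+n≡m t≤m))
... | no t≰m with () ← subst (i <_) (m≤n⇒m∸n≡0 (<⇒≤ (≰⇒> t≰m))) i<

four-n+1 : ∀ m → 4 * (suc (m + m) + 1) ≡ 8 * suc m
four-n+1 = solve-∀

ind : Bool → ℕ
ind true = 1
ind false = 0

count : (ℕ → Bool) → ℕ → ℕ
count f zero = 0
count f (suc P) = count f P + ind (f P)

count-cong : ∀ {f g} P → (∀ i → i < P → f i ≡ g i) → count f P ≡ count g P
count-cong zero eq = refl
count-cong (suc P) eq =
  cong₂ _+_ (count-cong P (λ i i<P → eq i (m<n⇒m<1+n i<P))) (cong ind (eq P ≤-refl))

count-mono : ∀ {f g} P → (∀ i → i < P → f i ≡ true → g i ≡ true) → count f P ≤ count g P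
count-mono zero imp = z≤n
count-mono {f} {g} (suc P) imp =
  +-mono-≤ (count-mono P (λ i i<P → imp i (m<n⇒m<1+n i<P))) (ind-mono (f P) (g P) (imp P ≤-refl))
  where
  ind-mono : ∀ a b → (a ≡ true → b ≡ true) → ind a ≤ ind b
  ind-mono false b _ = z≤n
  ind-mono true b imp′ rewrite imp′ refl = ≤-refl

count-grows : ∀ f {P Q} → P ≤ Q → count f P ≤ count f Q
count-grows f {P} {Q} P≤Q with d , refl ← m≤n⇒∃[o]m+o≡n P≤Q = go d
  where
  go : ∀ d → count f P ≤ count f (P + d)
  go zero = ≤-reflexive (cong (count f) (sym (+-identityʳ P)))
  go (suc d) = ≤-trans (≤-trans (go d) (m≤m+n _ _)) (≤-reflexive (cong (count f) (sym (+-suc P d))))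

count-≤ : ∀ f P → count f P ≤ P
count-≤ f zero = z≤n
count-≤ f (suc P) =
  ≤-trans (+-mono-≤ (count-≤ f P) (ind≤1 (f P))) (≤-reflexive (+-comm P 1))
  where
  ind≤1 : ∀ b → ind b ≤ 1
  ind≤1 true = ≤-refl
  ind≤1 false = z≤n

count-hit : ∀ f {a b i} → f i ≡ true → a ≤ i → i < b → suc (count f a) ≤ count f b
count-hit f {a} {b} {i} fi a≤i i<b = begin
  suc (count f a)         ≤⟨ s≤s (count-grows f a≤i) ⟩
  suc (count f i)         ≡⟨ +-comm 1 (count f i) ⟩
  count f i + 1           ≡⟨ cong (λ x → count f i + ind x) (sym fi) ⟩
  count f (suc i)         ≤⟨ count-grows f i<b ⟩
  count f b               ∎
  where open ≤-Reasoning

count-beyond : ∀ f P → (∀ j → P ≤ j → f j ≡ false) → ∀ Q → count f Q ≤ count f P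
count-beyond f P none zero = z≤n
count-beyond f P none (suc Q) with P ≤? Q
... | no P≰Q = count-grows f (≰⇒> P≰Q)
... | yes P≤Q rewrite none Q P≤Q = ≤-trans (≤-reflexive (+-identityʳ _)) (count-beyond f P none Q)

count-all : ∀ f P → (∀ i → i < P → f i ≡ true) → count f P ≡ P
count-all f zero all = refl
count-all f (suc P) all rewrite all P ≤-refl =
  trans (cong (_+ 1) (count-all f P (λ i i<P → all i (m<n⇒m<1+n i<P)))) (+-comm P 1)

count-none : ∀ f P → (∀ i → i < P → f i ≡ false) → count f P ≡ 0
count-none f zero none = refl
count-none f (suc P) none rewrite none P ≤-refl =
  trans (+-identityʳ _) (count-none f P (λ i i<P → none i (m<n⇒m<1+n i<P)))

count-even-odd : ∀ f P → count f (P + P) ≡ count (λ j → f (j + j)) P + count (λ j → f (suc (j + j))) P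
count-even-odd f zero = refl
count-even-odd f (suc P) = begin
  count f (suc P + suc P)
    ≡⟨ cong (count f ∘ suc) (+-suc P P) ⟩
  count f (P + P) + ind (f (P + P)) + ind (f (suc (P + P)))
    ≡⟨ cong (λ c → c + ind (f (P + P)) + ind (f (suc (P + P)))) (count-even-odd f P) ⟩
  count (λ j → f (j + j)) P + count (λ j → f (suc (j + j))) P + ind (f (P + P)) + ind (f (suc (P + P)))
    ≡⟨ interleave (count (λ j → f (j + j)) P) _ _ _ ⟩
  count (λ j → f (j + j)) (suc P) + count (λ j → f (suc (j + j))) (suc P)
    ∎
  where
  open ≡-Reasoning
  interleave : ∀ a b x y → a + b + x + y ≡ (a + x) + (b + y)
  interleave = solve-∀

count-unique : ∀ f P → (∀ i j → f i ≡ true → f j ≡ true → i ≡ j) → count f P ≤ 1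
count-unique f zero _ = z≤n
count-unique f (suc P) unique with f P in fP
... | false = ≤-trans (≤-reflexive (+-identityʳ _)) (count-unique f P unique)
... | true = ≤-reflexive (cong (_+ 1) (count-none f P earlier-unmarked))
  where
  earlier-unmarked : ∀ i → i < P → f i ≡ false
  earlier-unmarked i i<P with f i in fi
  ... | false = refl
  ... | true = ⊥-elim (<-irrefl (unique i P fi fP) i<P)

count-∨ : ∀ f h P → count (λ i → f i ∨ h i) P ≤ count f P + count h P
count-∨ f h zero = z≤n
count-∨ f h (suc P) = begin
  count (λ i → f i ∨ h i) P + ind (f P ∨ h P)        ≤⟨ +-mono-≤ (count-∨ f h P) (ind-∨ (f P) (h P)) ⟩
  count f P + count h P + (ind (f P) + ind (h P))    ≡⟨ interleave (count f P) _ _ _ ⟩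
  count f P + ind (f P) + (count h P + ind (h P))    ∎
  where
  open ≤-Reasoning
  ind-∨ : ∀ a b → ind (a ∨ b) ≤ ind a + ind b
  ind-∨ true b = s≤s z≤n
  ind-∨ false b = ≤-refl
  interleave : ∀ a b x y → a + b + (x + y) ≡ a + x + (b + y)
  interleave = solve-∀

from-does : ∀ {A : Set} (d : Dec A) → does d ≡ true → A
from-does (yes a) _ = a

count-members : ∀ (g : ℕ → ℕ) → (∀ i j → g i ≡ g j → i ≡ j) →
                ∀ xs P → count (λ i → does (g i ∈? xs)) P ≤ length xs
count-members g g-inj [] P = ≤-reflexive (count-none _ P (λ _ _ → refl))
count-members g g-inj (x ∷ xs) P =
  ≤-trans (count-∨ (λ i → does (g i ≟ x)) (λ i → does (g i ∈? xs)) P)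
          (+-mono-≤ (count-unique _ P hits-x-once) (count-members g g-inj xs P))
  where
  hits-x-once : ∀ i j → does (g i ≟ x) ≡ true → does (g j ≟ x) ≡ true → i ≡ j
  hits-x-once i j gi gj = g-inj i j (trans (from-does (g i ≟ x) gi) (sym (from-does (g j ≟ x) gj)))

Near : (ℕ → Bool) → ℕ → ℕ → Set
Near g t j = ∃ λ i → g i ≡ true × i ≤ j + t × j ≤ i + t

-- Covering bound: if every j < M lies below L or near a marked point, then
-- M ≤ L + (2t + 1)·#{marked points below M + t}, since each marked point is
-- near at most 2t + 1 values of j.
covering-bound : ∀ g t L M → (∀ j → j < M → j < L ⊎ Near g t j) →
                 M ≤ L + (2 * t + 1) * count g (M + t)
covering-bound g t L = <-rec Goal extend
  where
  D = 2 * t + 1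
  Goal : ℕ → Set
  Goal M = (∀ j → j < M → j < L ⊎ Near g t j) → M ≤ L + D * count g (M + t)
  extend : ∀ M → (∀ {M′} → M′ < M → Goal M′) → Goal M
  extend zero _ _ = z≤n
  extend (suc M) ih covered with covered M ≤-refl
  ... | inj₁ M<L = ≤-trans M<L (m≤m+n L _)
  ... | inj₂ (i , gi , i≤M+t , M≤i+t) with 2 * t ≤? M
  ...   | no M<2t = begin
      suc M                          ≤⟨ ≤-trans (≰⇒> M<2t) (m≤m+n (2 * t) 1) ⟩
      D                              ≡⟨ *-identityʳ D ⟨
      D * 1                          ≤⟨ *-monoʳ-≤ D (count-hit g gi z≤n (s≤s i≤M+t)) ⟩
      D * count g (suc M + t)        ≤⟨ m≤n+m _ L ⟩
      L + D * count g (suc M + t)    ∎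
    where open ≤-Reasoning
  ...   | yes 2t≤M with M′ , refl ← m≤n⇒∃[o]m+o≡n 2t≤M = begin
      suc (2 * t + M′)                    ≡⟨ shift t M′ ⟩
      M′ + D                              ≤⟨ +-monoˡ-≤ D (ih (s≤s (m≤n+m M′ (2 * t))) covered-below) ⟩
      L + D * count g (M′ + t) + D        ≡⟨ absorb L D (count g (M′ + t)) ⟩
      L + D * suc (count g (M′ + t))      ≤⟨ +-monoʳ-≤ L (*-monoʳ-≤ D hit) ⟩
      L + D * count g (suc (2 * t + M′) + t) ∎
    where
    open ≤-Reasoning
    covered-below : ∀ j → j < M′ → j < L ⊎ Near g t j
    covered-below j j<M′ = covered j (≤-trans j<M′ (≤-trans (m≤n+m M′ (2 * t)) (n≤1+n _)))
    far : ∀ t M′ → t + (M′ + t) ≡ 2 * t + M′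
    far = solve-∀
    hit : suc (count g (M′ + t)) ≤ count g (suc (2 * t + M′) + t)
    hit = count-hit g gi (+-cancelˡ-≤ t _ _ (subst (_≤ t + i) (sym (far t M′)) (subst (2 * t + M′ ≤_) (+-comm i t) M≤i+t)))
                      (s≤s i≤M+t)
    shift : ∀ t M′ → suc (2 * t + M′) ≡ M′ + (2 * t + 1)
    shift = solve-∀
    absorb : ∀ L D c → L + D * c + D ≡ L + D * suc c
    absorb = solve-∀

count-shift : ∀ f P → count f (suc P) ≡ ind (f 0) + count (λ i → f (suc i)) P
count-shift f zero = +-comm 0 (ind (f 0))
count-shift f (suc P) = begin
  count f (suc P) + ind (f (suc P))                          ≡⟨ cong (_+ ind (f (suc P))) (count-shift f P) ⟩
  ind (f 0) + count (λ i → f (suc i)) P + ind (f (suc P))    ≡⟨ +-assoc (ind (f 0)) _ _ ⟩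
  ind (f 0) + count (λ i → f (suc i)) (suc P)                ∎
  where open ≡-Reasoning

marks : ∀ {k} → Subset k → ℕ → Bool
marks [] _ = false
marks (x ∷ xs) zero = x
marks (x ∷ xs) (suc p) = marks xs p

size-count : ∀ {k} (xs : Subset k) → ∣ xs ∣ ≡ count (marks xs) k
size-count [] = refl
size-count {suc k} (true ∷ xs) = trans (cong suc (size-count xs)) (sym (count-shift (marks (true ∷ xs)) k))
size-count {suc k} (false ∷ xs) = trans (size-count xs) (sym (count-shift (marks (false ∷ xs)) k))

marks-∈ : ∀ {k} {xs : Subset k} {x : Fin k} → x ∈ xs → marks xs (toℕ x) ≡ true
marks-∈ here = refl
marks-∈ (there x∈xs) = marks-∈ x∈xs

marks-beyond : ∀ {k} (xs : Subset k) p → k ≤ p → marks xs p ≡ false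
marks-beyond [] p _ = refl
marks-beyond (x ∷ xs) (suc p) (s≤s k≤p) = marks-beyond xs p k≤p

marks-tabulate : ∀ {k} (f : ℕ → Bool) p → p < k → marks (tabulate {n = k} (λ v → f (toℕ v))) p ≡ f p
marks-tabulate {suc k} f zero _ = refl
marks-tabulate {suc k} f (suc p) (s≤s p<k) = marks-tabulate {k} (λ i → f (suc i)) p p<k

size-even-odd : ∀ m (B : Subset (suc (m + m))) →
                ∣ B ∣ ≡ count (λ j → marks B (j + j)) (suc m) + count (λ j → marks B (suc (j + j))) (suc m)
size-even-odd m B = begin
  ∣ B ∣                                                          ≡⟨ size-count B ⟩
  count (marks B) (suc (m + m))                                  ≡⟨ +-identityʳ _ ⟨
  count (marks B) (suc (m + m)) + 0                              ≡⟨ cong (λ b → count (marks B) (suc (m + m)) + ind b) (marks-beyond B _ ≤-refl) ⟨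
  count (marks B) (suc (suc (m + m)))                            ≡⟨ cong (λ k → count (marks B) (suc k)) (+-suc m m) ⟨
  count (marks B) (suc m + suc m)                                ≡⟨ count-even-odd (marks B) (suc m) ⟩
  count (λ j → marks B (j + j)) (suc m) + count (λ j → marks B (suc (j + j))) (suc m) ∎
  where open ≡-Reasoning

-- Index 2m + 1 lies outside Fin (2m + 1).
odd-indices : ∀ m (B : Subset (suc (m + m))) →
              count (λ j → marks B (suc (j + j))) (suc m) ≡ count (λ j → marks B (suc (j + j))) m
odd-indices m B = trans (cong (λ b → count (λ j → marks B (suc (j + j))) m + ind b) (marks-beyond B _ ≤-refl)) (+-identityʳ _)

isOdd : ℕ → Bool
isOdd zero = false
isOdd (suc k) = not (isOdd k)

odd-double : ∀ j → isOdd (j + j) ≡ false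
odd-double zero = refl
odd-double (suc j) rewrite +-suc j j | odd-double j = refl

odd-suc-double : ∀ j → isOdd (suc (j + j)) ≡ true
odd-suc-double j rewrite odd-double j = refl

halve : ∀ w → isOdd w ≡ false → ∃ λ j → w ≡ j + j
halve w even with even-or-odd w
... | j , inj₁ w≡j+j = j , w≡j+j
... | j , inj₂ refl with () ← trans (sym (odd-suc-double j)) even

double-injective : ∀ j k → j + j ≡ k + k → j ≡ k
double-injective j k eq = *-cancelˡ-≡ j k 2 (trans (cong (j +_) (+-identityʳ j)) (trans eq (cong (k +_) (sym (+-identityʳ k)))))

odd≢double : ∀ j k → suc (j + j) ≢ k + k
odd≢double j k eq with () ← trans (sym (odd-suc-double j)) (trans (cong isOdd eq) (odd-double k))

-- The direction of the first edge 0 — 1 (false if there is no edge).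
firstArc : ∀ {n} → Digraph n → Bool
firstArc {suc (suc _)} Γ = Γ fzero (fsuc fzero)
firstArc {_}           Γ = false

first-edge : ∀ {n} (Γ : Digraph n) (u v : Fin n) → toℕ u ≡ 0 → toℕ v ≡ 1 → Γ u v ≡ firstArc Γ
first-edge {suc (suc _)} Γ fzero (fsuc fzero) _ _ = refl
first-edge Γ fzero fzero _ ()
first-edge Γ fzero (fsuc (fsuc _)) _ ()
first-edge Γ (fsuc _) _ () _

isOdd-ind : ∀ b → isOdd (ind b) ≡ b
isOdd-ind true = refl
isOdd-ind false = refl

-- The structure of an alternating orientation of a path: it is determined by
-- the direction of the first edge; vertex i is a source iff i + ε is odd,
-- where ε = 1 if vertex 0 is a source and ε = 0 otherwise, and every source
-- points to both of its path neighbours.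
module AlternatingPath {n : ℕ} (Γ : Digraph n) (orient : IsOrientationOfPath Γ) (alt : IsAlternating Γ) where

  isSource : Fin n → Bool
  isSource u = isOdd (toℕ u + ind (firstArc Γ))

  no-transit : ∀ {w u v} → Γ w u ≡ true → Γ u v ≡ true → ⊥
  no-transit {w} {u} {v} wu uv with alt u
  ... | inj₁ no-in with () ← trans (sym wu) (no-in w)
  ... | inj₂ no-out with () ← trans (sym uv) (no-out v)

  one-way : ∀ {u v} → suc (toℕ u) ≡ toℕ v → Γ v u ≡ not (Γ u v)
  one-way {u} {v} edge with proj₂ orient u v edge
  ... | inj₁ (uv , vu) rewrite uv = vu
  ... | inj₂ (uv , vu) rewrite uv = vu

  alternate : ∀ {w u v} → suc (toℕ w) ≡ toℕ u → suc (toℕ u) ≡ toℕ v → Γ u v ≡ not (Γ w u)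
  alternate {w} {u} {v} wu-edge uv-edge with Γ w u in wu | Γ u v in uv
  ... | true  | false = refl
  ... | false | true  = refl
  ... | true  | true  = ⊥-elim (no-transit wu uv)
  ... | false | false = ⊥-elim (no-transit vu uw)
    where
    uw : Γ u w ≡ true
    uw = trans (one-way wu-edge) (cong not wu)
    vu : Γ v u ≡ true
    vu = trans (one-way uv-edge) (cong not uv)

  arc-forward : ∀ i {u v} → toℕ u ≡ i → suc i ≡ toℕ v → Γ u v ≡ isOdd (i + ind (firstArc Γ))
  arc-forward zero {u} {v} u≡0 v≡1 = trans (first-edge Γ u v u≡0 (sym v≡1)) (sym (isOdd-ind (firstArc Γ)))
  arc-forward (suc i) {u} {v} u≡i+1 v≡i+2 = begin
    Γ u v      ≡⟨ alternate (trans (cong suc (toℕ-fromℕ< i<n)) (sym u≡i+1)) (trans (cong suc u≡i+1) v≡i+2) ⟩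
    not (Γ w u) ≡⟨ cong not (arc-forward i (toℕ-fromℕ< i<n) (sym u≡i+1)) ⟩
    isOdd (suc i + ind (firstArc Γ)) ∎
    where
    open ≡-Reasoning
    i<n : i < n
    i<n = ≤-trans (≤-reflexive (sym u≡i+1)) (<⇒≤ (toℕ<n u))
    w : Fin n
    w = fromℕ< i<n

  arc-source : ∀ {u x} → Γ u x ≡ true → isSource u ≡ true × PathAdj u x
  arc-source {u} {x} ux with proj₁ orient u x ux
  ... | inj₁ forward = trans (sym (arc-forward (toℕ u) refl forward)) ux , inj₁ forward
  ... | inj₂ backward = source , inj₂ backward
    where
    source : isSource u ≡ true
    source = begin
      isOdd (toℕ u + ind (firstArc Γ))        ≡⟨ cong (λ k → isOdd (k + ind (firstArc Γ))) (sym backward) ⟩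
      not (isOdd (toℕ x + ind (firstArc Γ)))  ≡⟨ cong not (sym (arc-forward (toℕ x) refl backward)) ⟩
      not (Γ x u)                              ≡⟨ trans (sym (one-way backward)) ux ⟩
      true                                     ∎
      where open ≡-Reasoning

  source-arc : ∀ {u x} → isSource u ≡ true → PathAdj u x → Γ u x ≡ true
  source-arc {u} {x} source (inj₁ forward) = trans (arc-forward (toℕ u) refl forward) source
  source-arc {u} {x} source (inj₂ backward) = begin
    Γ u x                                     ≡⟨ one-way backward ⟩
    not (Γ x u)                               ≡⟨ cong not (arc-forward (toℕ x) refl backward) ⟩
    isOdd (suc (toℕ x) + ind (firstArc Γ))     ≡⟨ cong (λ k → isOdd (k + ind (firstArc Γ))) backward ⟩
    isSource u                                 ≡⟨ source ⟩
    true                                       ∎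
    where open ≡-Reasoning

  -- Arcs end at sinks: a source v would send an arc back to u.
  arc-target-sink : ∀ {u v} → Γ u v ≡ true → isSource v ≡ false
  arc-target-sink {u} {v} uv with isSource v in source-v
  ... | false = refl
  ... | true = ⊥-elim (no-transit uv (source-arc source-v (flip (proj₂ (arc-source uv)))))
    where
    flip : PathAdj u v → PathAdj v u
    flip (inj₁ forward) = inj₂ forward
    flip (inj₂ backward) = inj₁ backward

clamp : (k p : ℕ) → Fin (suc k)
clamp zero p = fzero
clamp (suc k) zero = fzero
clamp (suc k) (suc p) = fsuc (clamp k p)

toℕ-clamp : ∀ k p → p ≤ k → toℕ (clamp k p) ≡ p
toℕ-clamp zero zero _ = refl
toℕ-clamp (suc k) zero _ = refl
toℕ-clamp (suc k) (suc p) (s≤s p≤k) = cong suc (toℕ-clamp k p p≤k)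

-- Positions on an alternating path with an odd number n = 2m + 1 of vertices:
-- vertex i sits at position i + ε, where ε ∈ {0,1} records whether vertex 0
-- is a source.  Then sources sit at odd and sinks at even positions, and the
-- sink at position 2j is called sink number j.
module Positions (m : ℕ) (Γ : Digraph (suc (m + m))) (orient : IsOrientationOfPath Γ) (alt : IsAlternating Γ) where
  open AlternatingPath Γ orient alt public

  n : ℕ
  n = suc (m + m)

  ε : ℕ
  ε = ind (firstArc Γ)

  ε≤1 : ε ≤ 1
  ε≤1 with firstArc Γ
  ... | true = ≤-refl
  ... | false = z≤n

  pos : Fin n → ℕ
  pos v = toℕ v + ε

  pos-≥ : ∀ v → ε ≤ pos v
  pos-≥ v = m≤n+m ε (toℕ v)

  pos-≤ : ∀ v → pos v ≤ m + m + ε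
  pos-≤ v = +-monoˡ-≤ ε (s≤s⁻¹ (toℕ<n v))

  pos-injective : ∀ {u v} → pos u ≡ pos v → u ≡ v
  pos-injective eq = toℕ-injective (+-cancelʳ-≡ ε _ _ eq)

  adjacent-pos : ∀ {u v} → PathAdj u v → suc (pos u) ≡ pos v ⊎ suc (pos v) ≡ pos u
  adjacent-pos (inj₁ forward) = inj₁ (cong (_+ ε) forward)
  adjacent-pos (inj₂ backward) = inj₂ (cong (_+ ε) backward)

  pos-adjacent : ∀ {u v} → suc (pos u) ≡ pos v ⊎ suc (pos v) ≡ pos u → PathAdj u v
  pos-adjacent (inj₁ forward) = inj₁ (+-cancelʳ-≡ ε _ _ forward)
  pos-adjacent (inj₂ backward) = inj₂ (+-cancelʳ-≡ ε _ _ backward)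

  vertexAt : ℕ → Fin n
  vertexAt w = clamp (m + m) (w ∸ ε)

  pos-vertexAt : ∀ {w} → ε ≤ w → w ≤ m + m + ε → pos (vertexAt w) ≡ w
  pos-vertexAt {w} ε≤w w≤last =
    trans (cong (_+ ε) (toℕ-clamp (m + m) (w ∸ ε) (subst (w ∸ ε ≤_) (m+n∸n≡m (m + m) ε) (∸-monoˡ-≤ ε w≤last))))
          (m∸n+n≡m ε≤w)

  vertexAt-pos : ∀ v → vertexAt (pos v) ≡ v
  vertexAt-pos v = pos-injective (pos-vertexAt (pos-≥ v) (pos-≤ v))

  source-pos-arc : ∀ {u x} → isOdd (pos u) ≡ true → suc (pos u) ≡ pos x ⊎ suc (pos x) ≡ pos u → Γ u x ≡ true
  source-pos-arc source adj = source-arc source (pos-adjacent adj)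

  start-cases : (firstArc Γ ≡ false × ε ≡ 0) ⊎ (firstArc Γ ≡ true × ε ≡ 1)
  start-cases with firstArc Γ
  ... | false = inj₁ (refl , refl)
  ... | true = inj₂ (refl , refl)

  -- j is the number of a sink of the path, which sits at position 2j.
  SinkNumber : ℕ → Set
  SinkNumber j = ε ≤ j + j × j + j ≤ m + m + ε

  sinkAt : ℕ → Fin n
  sinkAt j = vertexAt (j + j)

  pos-sinkAt : ∀ {j} → SinkNumber j → pos (sinkAt j) ≡ j + j
  pos-sinkAt (ε≤ , ≤last) = pos-vertexAt ε≤ ≤last

  sink-number : ∀ {x j} → pos x ≡ j + j → SinkNumber j
  sink-number {x} pos-x = subst (ε ≤_) pos-x (pos-≥ x) , subst (_≤ m + m + ε) pos-x (pos-≤ x)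

  sinkAt-pos : ∀ {x j} → pos x ≡ j + j → x ≡ sinkAt j
  sinkAt-pos {x} pos-x = trans (sym (vertexAt-pos x)) (cong vertexAt pos-x)

  sinkAt-injective : ∀ {j j′} → SinkNumber j → SinkNumber j′ → sinkAt j ≡ sinkAt j′ → j ≡ j′
  sinkAt-injective {j} {j′} sj sj′ eq = double-injective j j′ (trans (sym (pos-sinkAt {j} sj)) (trans (cong pos eq) (pos-sinkAt {j′} sj′)))

  sink-number-≤ : ∀ {j} → SinkNumber j → j ≤ m
  sink-number-≤ {j} (_ , ≤last) with j ≤? m
  ... | yes j≤m = j≤m
  ... | no j≰m = ⊥-elim (<⇒≱ (begin-strict
    m + m + ε       ≤⟨ +-monoʳ-≤ (m + m) ε≤1 ⟩
    m + m + 1       ≡⟨ +-comm (m + m) 1 ⟩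
    suc (m + m)     <⟨ s≤s (+-monoʳ-< m (n<1+n m)) ⟩
    suc m + suc m   ≤⟨ +-mono-≤ (≰⇒> j≰m) (≰⇒> j≰m) ⟩
    j + j           ∎) ≤last)
    where open ≤-Reasoning

  SinkNumber? : ∀ j → Dec (SinkNumber j)
  SinkNumber? j = (ε ≤? j + j) ×-dec (j + j ≤? m + m + ε)

  out-neighbours : ∀ {u x j} → pos u ≡ suc (j + j) → Γ u x ≡ true → pos x ≡ j + j ⊎ pos x ≡ suc j + suc j
  out-neighbours {u} {x} {j} pos-u ux with adjacent-pos (proj₂ (arc-source ux))
  ... | inj₁ forward = inj₂ (trans (sym forward) (trans (cong suc pos-u) (cong suc (sym (+-suc j j)))))
  ... | inj₂ backward = inj₁ (cong pred (trans backward pos-u))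

module Stages {n : ℕ} (Γ : Digraph n) (B : Subset n) (F : List (Force n)) where
  open DecMembership (≡-dec (Fin._≟_ {n}) (Fin._≟_ {n})) using () renaming (_∈?_ to _∈ₗ?_)

  Stage : ℕ → Fin n → Set
  Stage = InStage Γ B F

  stage? : ∀ t v → Dec (Stage t v)
  stage? zero v = v SubsetP.∈? B
  stage? (suc t) v =
    stage? t v ⊎-dec (¬? (stage? t v) ×-dec anyFin? λ u →
      ((u , v) ∈ₗ? F) ×-dec stage? t u ×-dec (Γ u v BoolP.≟ true) ×-dec
      allFin? (λ x → (Γ u x BoolP.≟ true) →-dec (¬? (stage? t x) →-dec (x Fin.≟ v))))

  stage-mono : ∀ {d d′ v} → d ≤ d′ → Stage d v → Stage d′ v
  stage-mono {d′ = zero} z≤n v∈ = v∈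
  stage-mono {d′ = suc d′} d≤ v∈ with m≤n⇒m<n∨m≡n d≤
  ... | inj₁ d<d′+1 = inj₁ (stage-mono (s≤s⁻¹ d<d′+1) v∈)
  ... | inj₂ refl = v∈

  initial : ∀ {d v} → v ∈ B → Stage d v
  initial = stage-mono z≤n

  OthersBlue : ℕ → Fin n → Fin n → Set
  OthersBlue d u w = ∀ x → Γ u x ≡ true → x ≡ w ⊎ Stage d x

  force-step : ∀ {d u w} → Stage d u → (u , w) ∈ₗ F → Γ u w ≡ true → OthersBlue d u w → Stage (suc d) w
  force-step {d} {u} {w} u∈ listed arc others with stage? d w
  ... | yes w∈ = inj₁ w∈
  ... | no w∉ = inj₂ (w∉ , u , listed , u∈ , arc , only-w)
    where
    only-w : ∀ x → Γ u x ≡ true → ¬ Stage d x → x ≡ w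
    only-w x ux x∉ with others x ux
    ... | inj₁ x≡w = x≡w
    ... | inj₂ x∈ = ⊥-elim (x∉ x∈)

  entered : ∀ {d w} → Stage (suc d) w → Stage d w ⊎ (∃ λ u → Stage d u × Γ u w ≡ true × OthersBlue d u w)
  entered (inj₁ w∈) = inj₁ w∈
  entered {d} {w} (inj₂ (_ , u , _ , u∈ , arc , only-w)) = inj₂ (u , u∈ , arc , others)
    where
    others : OthersBlue d u w
    others x ux with stage? d x
    ... | yes x∈ = inj₂ x∈
    ... | no x∉ = inj₁ (only-w x ux x∉)

module LowerBound (m : ℕ) (Γ : Digraph (suc (m + m))) (orient : IsOrientationOfPath Γ) (alt : IsAlternating Γ)
                  (B : Subset (suc (m + m))) (F : List (Force (suc (m + m)))) where
  open Positions m Γ orient alt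
  open Stages Γ B F

  -- Sources have no in-arcs, so they are never forced.
  source-initial : ∀ {d v} → isSource v ≡ true → Stage d v → v ∈ B
  source-initial {zero} _ v∈ = v∈
  source-initial {suc d} {v} source v∈ with entered v∈
  ... | inj₁ v∈d = source-initial source v∈d
  ... | inj₂ (u , _ , arc , _) with () ← trans (sym source) (arc-target-sink arc)

  -- A centre is the number c of an initially blue sink or, when vertex 0 is
  -- a source, one of the virtual sink numbers 0 and m + 1 just off the path.
  Centre : ℕ → Set
  Centre c = (∃ λ x → x ∈ B × pos x ≡ c + c) ⊎ (firstArc Γ ≡ true × (c ≡ 0 ⊎ c ≡ suc m))

  NearCentre : ℕ → ℕ → Set
  NearCentre d j = ∃ λ c → Centre c × c ≤ j + d × j ≤ c + d

  near-later : ∀ {d j} → NearCentre d j → NearCentre (suc d) j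
  near-later {d} {j} (c , centre , c≤ , j≤) = c , centre , ≤-trans c≤ (+-monoʳ-≤ j (n≤1+n d)) , ≤-trans j≤ (+-monoʳ-≤ c (n≤1+n d))

  near-right : ∀ {d j} → NearCentre d j → NearCentre (suc d) (suc j)
  near-right {d} {j} (c , centre , c≤ , j≤) = c , centre , ≤-trans c≤ (+-mono-≤ (n≤1+n j) (n≤1+n d)) , ≤-trans (s≤s j≤) (≤-reflexive (sym (+-suc c d)))

  near-left : ∀ {d j} → NearCentre d (suc j) → NearCentre (suc d) j
  near-left {d} {j} (c , centre , c≤ , j≤) = c , centre , ≤-trans c≤ (≤-reflexive (sym (+-suc j d))) , ≤-trans (n≤1+n j) (≤-trans j≤ (+-monoʳ-≤ c (n≤1+n d)))

  left-end : ∀ j → ¬ (ε ≤ j + j) → firstArc Γ ≡ true × j ≡ 0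
  left-end j ε≰ with start-cases
  ... | inj₁ (_ , ε≡0) = ⊥-elim (ε≰ (subst (_≤ j + j) (sym ε≡0) z≤n))
  ... | inj₂ (first , ε≡1) with j
  ...   | zero = first , refl
  ...   | suc j′ = ⊥-elim (ε≰ (subst (_≤ suc j′ + suc j′) (sym ε≡1) (s≤s z≤n)))

  right-end : ∀ j → suc (j + j) ≤ m + m + ε → ¬ (suc j + suc j ≤ m + m + ε) → firstArc Γ ≡ true × j ≡ m
  right-end j in-path ≰ with start-cases
  ... | inj₁ (_ , ε≡0) = ⊥-elim (odd≢double j m (trans last (trans (cong (m + m +_) ε≡0) (+-identityʳ _))))
    where
    last : suc (j + j) ≡ m + m + ε
    last = ≤-antisym in-path (s≤s⁻¹ (≤-trans (≰⇒> ≰) (≤-reflexive (cong suc (+-suc j j)))))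
  ... | inj₂ (first , ε≡1) = first , double-injective j m (cong pred (trans last (trans (cong (m + m +_) ε≡1) (+-comm (m + m) 1))))
    where
    last : suc (j + j) ≡ m + m + ε
    last = ≤-antisym in-path (s≤s⁻¹ (≤-trans (≰⇒> ≰) (≤-reflexive (cong suc (+-suc j j)))))

  SinksNear : ℕ → Set
  SinksNear d = ∀ v j → pos v ≡ j + j → Stage d v → NearCentre d j

  -- A sink forced at time d + 1 by its left neighbour u: u's other sink,
  -- one step closer to the centre, was blue at time d (or does not exist).
  forced-from-left : ∀ {d u v} j → SinksNear d → isSource u ≡ true → OthersBlue d u v →
                     suc (pos u) ≡ pos v → pos v ≡ j + j → NearCentre (suc d) j
  forced-from-left zero _ _ _ u-left pos-v with () ← trans u-left pos-v
  forced-from-left {d} {u} {v} (suc j) near source others u-left pos-v with ε ≤? j + j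
  ... | no ε≰ with first , refl ← left-end j ε≰ = 0 , inj₂ (first , inj₁ refl) , z≤n , s≤s z≤n
  ... | yes ε≤ = near-right (near x j pos-x x∈)
    where
    pos-u : pos u ≡ suc (j + j)
    pos-u = cong pred (trans u-left (trans pos-v (cong suc (+-suc j j))))
    x = vertexAt (j + j)
    pos-x : pos x ≡ j + j
    pos-x = pos-vertexAt ε≤ (≤-trans (n≤1+n _) (subst (_≤ m + m + ε) pos-u (pos-≤ u)))
    x∈ : Stage d x
    x∈ with others x (source-pos-arc source (inj₂ (trans (cong suc pos-x) (sym pos-u))))
    ... | inj₂ x∈d = x∈d
    ... | inj₁ refl with () ← <-irrefl (double-injective j (suc j) (trans (sym pos-x) pos-v)) ≤-refl

  forced-from-right : ∀ {d u v} j → SinksNear d → isSource u ≡ true → OthersBlue d u v →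
                      suc (pos v) ≡ pos u → pos v ≡ j + j → NearCentre (suc d) j
  forced-from-right {d} {u} {v} j near source others u-right pos-v with suc j + suc j ≤? m + m + ε
  ... | no ≰ with first , refl ← right-end j (subst (_≤ m + m + ε) (trans (sym u-right) (cong suc pos-v)) (pos-≤ u)) ≰ =
    suc m , inj₂ (first , inj₂ refl) , ≤-trans (s≤s (m≤m+n m d)) (≤-reflexive (sym (+-suc m d))) , ≤-trans (n≤1+n m) (m≤m+n (suc m) (suc d))
  ... | yes ≤last = near-left (near x (suc j) pos-x x∈)
    where
    pos-u : pos u ≡ suc (j + j)
    pos-u = trans (sym u-right) (cong suc pos-v)
    x = vertexAt (suc j + suc j)
    pos-x : pos x ≡ suc j + suc j
    pos-x = pos-vertexAt (≤-trans ε≤1 (s≤s z≤n)) ≤last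
    x∈ : Stage d x
    x∈ with others x (source-pos-arc source (inj₁ (trans (cong suc pos-u) (trans (cong suc (sym (+-suc j j))) (sym pos-x)))))
    ... | inj₂ x∈d = x∈d
    ... | inj₁ refl with () ← <-irrefl (double-injective j (suc j) (trans (sym pos-v) pos-x)) ≤-refl

  -- By induction on d: a sink entering stage d + 1 was forced by a
  -- neighbouring source.
  sink-near-centre : ∀ d → SinksNear d
  sink-near-centre zero v j pos-v v∈B = j , inj₁ (v , v∈B , pos-v) , m≤m+n j 0 , m≤m+n j 0
  sink-near-centre (suc d) v j pos-v v∈ with entered v∈
  ... | inj₁ v∈d = near-later (sink-near-centre d v j pos-v v∈d)
  ... | inj₂ (u , _ , arc , others) with arc-source arc
  ...   | source , adj with adjacent-pos adj
  ...     | inj₁ u-left = forced-from-left j (sink-near-centre d) source others u-left pos-v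
  ...     | inj₂ u-right = forced-from-right j (sink-near-centre d) source others u-right pos-v

  evens odds : ℕ
  evens = count (λ j → marks B (j + j)) (suc m)
  odds = count (λ j → marks B (suc (j + j))) (suc m)

  index-sink-start : ε ≡ 0 → ∀ x → toℕ x ≡ pos x
  index-sink-start ε≡0 x = trans (sym (+-identityʳ (toℕ x))) (cong (toℕ x +_) (sym ε≡0))

  index-source-start : ε ≡ 1 → ∀ x → suc (toℕ x) ≡ pos x
  index-source-start ε≡1 x = trans (+-comm 1 (toℕ x)) (cong (toℕ x +_) (sym ε≡1))

  source-marked : ∀ {t} → StageFull Γ B F t → ∀ p → ε ≤ p → p ≤ m + m + ε → isOdd p ≡ true →
                  marks B (toℕ (vertexAt p)) ≡ true
  source-marked full p ε≤p p≤last odd =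
    marks-∈ (source-initial (trans (cong isOdd (pos-vertexAt ε≤p p≤last)) odd) (full (vertexAt p)))

  -- When vertex 0 is a sink: the m sources are blue, and the m + 1 sinks are
  -- covered by balls of radius t around the `evens` blue sinks.
  capacity-sink-start : ∀ t → StageFull Γ B F t → firstArc Γ ≡ false → ε ≡ 0 →
                        odds ≡ m × suc m ≤ (2 * t + 1) * evens
  capacity-sink-start t full first ε≡0 = odds≡m , covered
    where
    g = λ j → marks B (j + j)
    in-path : ∀ {j} → j ≤ m → j + j ≤ m + m + ε
    in-path j≤m = ≤-trans (+-mono-≤ j≤m j≤m) (m≤m+n (m + m) ε)
    sources : ∀ j → j < m → marks B (suc (j + j)) ≡ true
    sources j j<m = subst (λ p → marks B p ≡ true) (trans (index-sink-start ε≡0 _) (pos-vertexAt ε≤ ≤last))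
                          (source-marked full (suc (j + j)) ε≤ ≤last (odd-suc-double j))
      where
      ε≤ = ≤-trans ε≤1 (s≤s z≤n)
      ≤last = ≤-trans (+-mono-≤ j<m (<⇒≤ j<m)) (m≤m+n (m + m) ε)
    odds≡m : odds ≡ m
    odds≡m = trans (odd-indices m B) (count-all _ m sources)
    near : ∀ j → j < suc m → j < 0 ⊎ Near g t j
    near j j≤m with sink-near-centre t x j pos-x (full x)
      where
      x = vertexAt (j + j)
      pos-x = pos-vertexAt (subst (_≤ j + j) (sym ε≡0) z≤n) (in-path (s≤s⁻¹ j≤m))
    ... | c , inj₁ (y , y∈B , pos-y) , c≤ , j≤ =
      inj₂ (c , subst (λ p → marks B p ≡ true) (trans (index-sink-start ε≡0 y) pos-y) (marks-∈ y∈B) , c≤ , j≤)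
    ... | c , inj₂ (first′ , _) , _ with () ← trans (sym first) first′
    covered : suc m ≤ (2 * t + 1) * evens
    covered = ≤-trans (covering-bound g t 0 (suc m) near)
                      (*-monoʳ-≤ (2 * t + 1) (count-beyond g (suc m) beyond (suc m + t)))
      where
      beyond : ∀ j → suc m ≤ j → g j ≡ false
      beyond j m<j = marks-beyond B (j + j) (≤-trans (s≤s (+-monoʳ-≤ m (n≤1+n m))) (+-mono-≤ m<j m<j))

  -- When vertex 0 is a source, sink i + 1 with i + t < m is within t of the
  -- virtual centre 0 (then i < t) or of a blue sink c + 1, which has index
  -- 2c + 1.
  source-start-near : ∀ t → StageFull Γ B F t → ε ≡ 1 →
                      ∀ i → i + t < m → i < t ⊎ Near (λ i → marks B (suc (i + i))) t i
  source-start-near t full ε≡1 i i+t<m with sink-near-centre t x (suc i) pos-x (full x)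
    where
    i<m = ≤-trans (s≤s (m≤m+n i t)) i+t<m
    x = vertexAt (suc i + suc i)
    pos-x = pos-vertexAt (≤-trans ε≤1 (s≤s z≤n)) (≤-trans (+-mono-≤ i<m i<m) (m≤m+n (m + m) ε))
  ... | zero , _ , _ , i<t = inj₁ i<t
  ... | suc c , inj₂ (_ , inj₂ refl) , m≤ , _ with () ← <⇒≱ i+t<m (s≤s⁻¹ m≤)
  ... | suc c , inj₁ (y , y∈B , pos-y) , c≤ , i≤ =
    inj₂ (c , subst (λ p → marks B p ≡ true) index-y (marks-∈ y∈B) , s≤s⁻¹ c≤ , s≤s⁻¹ i≤)
    where
    index-y : toℕ y ≡ suc (c + c)
    index-y = cong pred (trans (index-source-start ε≡1 y) (trans pos-y (cong suc (+-suc c c))))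

  -- When vertex 0 is a source: the m + 1 sources are blue, and the m sinks
  -- are covered by the virtual centres at both ends (t sinks each) and by
  -- balls of radius t around the `odds` blue sinks.
  capacity-source-start : ∀ t → StageFull Γ B F t → ε ≡ 1 →
                          evens ≡ suc m × suc m ≤ (2 * t + 1) * suc odds
  capacity-source-start t full ε≡1 = count-all _ (suc m) sources , covered
    where
    g = λ i → marks B (suc (i + i))
    last≡ : m + m + ε ≡ suc (m + m)
    last≡ = trans (cong (m + m +_) ε≡1) (+-comm (m + m) 1)
    sources : ∀ j → j < suc m → marks B (j + j) ≡ true
    sources j j≤m = subst (λ p → marks B p ≡ true) (cong pred (trans (index-source-start ε≡1 _) (pos-vertexAt ε≤ ≤last)))
                          (source-marked full (suc (j + j)) ε≤ ≤last (odd-suc-double j))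
      where
      ε≤ = ≤-trans ε≤1 (s≤s z≤n)
      ≤last = subst (suc (j + j) ≤_) (sym last≡) (s≤s (+-mono-≤ (s≤s⁻¹ j≤m) (s≤s⁻¹ j≤m)))
    near : ∀ i → i < m ∸ t → i < t ⊎ Near g t i
    near i i<m-t = source-start-near t full ε≡1 i (below-cut i<m-t)
    covered : suc m ≤ (2 * t + 1) * suc odds
    covered = begin
      suc m                                           ≤⟨ s≤s (m≤n+m∸n m t) ⟩
      suc (t + (m ∸ t))                               ≤⟨ s≤s (+-monoʳ-≤ t (covering-bound g t t (m ∸ t) near)) ⟩
      suc (t + (t + (2 * t + 1) * count g (m ∸ t + t))) ≤⟨ s≤s (+-monoʳ-≤ t (+-monoʳ-≤ t (*-monoʳ-≤ (2 * t + 1) fewer))) ⟩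
      suc (t + (t + (2 * t + 1) * odds))              ≡⟨ regroup t odds ⟩
      (2 * t + 1) * suc odds                          ∎
      where
      open ≤-Reasoning
      fewer : count g (m ∸ t + t) ≤ odds
      fewer = ≤-trans (count-beyond g m (λ j m≤j → marks-beyond B (suc (j + j)) (s≤s (+-mono-≤ m≤j m≤j))) (m ∸ t + t))
                      (count-grows g (n≤1+n m))
      regroup : ∀ t o → suc (t + (t + (2 * t + 1) * o)) ≡ (2 * t + 1) * suc o
      regroup = solve-∀

  capacity : ∀ t → StageFull Γ B F t → ∃ λ b → ∣ B ∣ ≡ m + b × suc m ≤ (2 * t + 1) * b
  capacity t full with start-cases
  ... | inj₁ (first , ε≡0) with odds≡m , covered ← capacity-sink-start t full first ε≡0 =
    evens , trans (size-even-odd m B) (trans (cong (evens +_) odds≡m) (+-comm evens m)) , covered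
  ... | inj₂ (_ , ε≡1) with evens≡ , covered ← capacity-source-start t full ε≡1 =
    suc odds , trans (size-even-odd m B) (trans (cong (_+ odds) evens≡) (sym (+-suc m odds))) , covered

  lower-bound : ∀ k → (2 * k ∸ 1) * (2 * k ∸ 1) < 4 * (suc (m + m) + 1) →
                ∀ t → StageFull Γ B F t → m + k ≤ ∣ B ∣ + t
  lower-bound k small t full with b , size , covered ← capacity t full = begin
    m + k        ≤⟨ +-monoʳ-≤ m (budget-lower (suc m) k b t (subst ((2 * k ∸ 1) * (2 * k ∸ 1) <_) (four-n+1 m) small) covered) ⟩
    m + (b + t)  ≡⟨ +-assoc m b t ⟨
    m + b + t    ≡⟨ cong (_+ t) size ⟨
    ∣ B ∣ + t    ∎
    where open ≤-Reasoning

module Performing {n : ℕ} (Γ : Digraph n) where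

  Pred : Set₁
  Pred = Fin n → Set

  _≐_ : Pred → Pred → Set
  P ≐ Q = ∀ x → (P x → Q x) × (Q x → P x)

  ≐-refl : ∀ {P} → P ≐ P
  ≐-refl x = (λ p → p) , (λ p → p)

  ≐-trans : ∀ {P Q R} → P ≐ Q → Q ≐ R → P ≐ R
  ≐-trans PQ QR x = (λ p → proj₁ (QR x) (proj₁ (PQ x) p)) , (λ r → proj₂ (PQ x) (proj₂ (QR x) r))

  _+blue_ : Pred → Fin n → Pred
  (P +blue w) x = P x ⊎ x ≡ w

  +blue-cong : ∀ {P Q} w → P ≐ Q → (P +blue w) ≐ (Q +blue w)
  +blue-cong w PQ x = (λ { (inj₁ p) → inj₁ (proj₁ (PQ x) p) ; (inj₂ eq) → inj₂ eq })
                    , (λ { (inj₁ q) → inj₁ (proj₂ (PQ x) q) ; (inj₂ eq) → inj₂ eq })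

  ForceOK : Pred → Fin n → Fin n → Set
  ForceOK P u w = P u × ¬ P w × Γ u w ≡ true × (∀ x → Γ u x ≡ true → ¬ P x → x ≡ w)

  ForceOK-cong : ∀ {P Q u w} → P ≐ Q → ForceOK Q u w → ForceOK P u w
  ForceOK-cong PQ (u∈ , w∉ , arc , only-w) =
    proj₂ (PQ _) u∈ , (λ w∈ → w∉ (proj₁ (PQ _) w∈)) , arc , (λ x ux x∉ → only-w x ux (λ x∈ → x∉ (proj₂ (PQ x) x∈)))

  data Performs : Pred → List (Force n) → Pred → Set₁ where
    none : ∀ {P Q} → P ≐ Q → Performs P [] Q
    next : ∀ {P Q u w L} → ForceOK P u w → Performs (P +blue w) L Q → Performs P ((u , w) ∷ L) Q

  performs-cong : ∀ {P P′ L Q} → P ≐ P′ → Performs P′ L Q → Performs P L Q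
  performs-cong PP′ (none P′Q) = none (≐-trans PP′ P′Q)
  performs-cong PP′ (next ok rest) = next (ForceOK-cong PP′ ok) (performs-cong (+blue-cong _ PP′) rest)

  performs-++ : ∀ {P Q R xs ys} → Performs P xs Q → Performs Q ys R → Performs P (xs ++ ys) R
  performs-++ (none PQ) later = performs-cong PQ later
  performs-++ (next ok rest) later = next ok (performs-++ rest later)

  update-∈ : ∀ {P : Pred} {S : Subset n} w → (∀ x → P x → x ∈ S) → ∀ x → (P +blue w) x → x ∈ (S [ w ]≔ inside)
  update-∈ {S = S} w from x (inj₂ refl) = lookup⇒[]= x _ (lookup∘update x S inside)
  update-∈ {S = S} w from x (inj₁ px) with x Fin.≟ w
  ... | yes refl = lookup⇒[]= x _ (lookup∘update x S inside)
  ... | no x≢w = lookup⇒[]= x _ (trans (lookup∘update′ x≢w S inside) ([]=⇒lookup (from x px)))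

  update-∉ : ∀ {P : Pred} {S : Subset n} w → (∀ x → x ∈ S → P x) → ∀ x → x ∈ (S [ w ]≔ inside) → (P +blue w) x
  update-∉ {S = S} w to x x∈ with x Fin.≟ w
  ... | yes x≡w = inj₂ x≡w
  ... | no x≢w = inj₁ (to x (lookup⇒[]= x S (trans (sym (lookup∘update′ x≢w S inside)) ([]=⇒lookup x∈))))

  performs-run : ∀ {P Q L} (S : Subset n) → (∀ x → x ∈ S → P x) → (∀ x → P x → x ∈ S) →
                 Performs P L Q → (∀ x → Q x) → Run Γ S L
  performs-run S to from (none PQ) all-blue =
    done λ { (_ , w , _ , w∉ , _) → w∉ (from w (proj₂ (PQ w) (all-blue w))) }
  performs-run S to from (next (u∈ , w∉ , arc , only-w) rest) all-blue =
    step (from _ u∈ , (λ w∈ → w∉ (to _ w∈)) , arc , (λ x ux x∉ → only-w x ux (λ px → x∉ (from x px))))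
         (performs-run _ (update-∉ _ to) (update-∈ _ from) rest all-blue)

  Accumulated : Pred → (ℕ → Set) → (ℕ → Set) → (ℕ → Fin n) → Pred
  Accumulated Base A D f x = Base x ⊎ ∃ λ j → A j × D j × x ≡ f j

  optional : ∀ {D : Set} → Dec D → Force n → List (Force n)
  optional (yes _) φ = φ ∷ []
  optional (no _) _ = []

  optional-∈ : ∀ {D : Set} (D? : Dec D) φ → D → φ ∈ₗ optional D? φ
  optional-∈ (yes _) φ _ = here refl
  optional-∈ (no ¬d) φ d = ⊥-elim (¬d d)

  perform-optional : ∀ {Base A A′ D f u} J (D? : Dec (D J)) →
                     (∀ j → A j → A′ j) → (∀ j → A′ j → A j ⊎ j ≡ J) → A′ J →
                     (D J → ForceOK (Accumulated Base A D f) u (f J)) →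
                     Performs (Accumulated Base A D f) (optional D? (u , f J)) (Accumulated Base A′ D f)
  perform-optional {Base} {A} {A′} {D} {f} J (yes d) grow split J∈ valid = next (valid d) (none added)
    where
    added : (Accumulated Base A D f +blue f J) ≐ Accumulated Base A′ D f
    added x = (λ { (inj₁ (inj₁ b)) → inj₁ b
                 ; (inj₁ (inj₂ (j , a , dj , eq))) → inj₂ (j , grow j a , dj , eq)
                 ; (inj₂ eq) → inj₂ (J , J∈ , d , eq) })
            , (λ { (inj₁ b) → inj₁ (inj₁ b)
                 ; (inj₂ (j , a′ , dj , eq)) → [ (λ a → inj₁ (inj₂ (j , a , dj , eq))) , (λ { refl → inj₂ eq }) ]′ (split j a′) })
  perform-optional {Base} {A} {A′} {D} {f} J (no ¬d) grow split J∈ valid = none unchanged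
    where
    unchanged : Accumulated Base A D f ≐ Accumulated Base A′ D f
    unchanged x = (λ { (inj₁ b) → inj₁ b ; (inj₂ (j , a , dj , eq)) → inj₂ (j , grow j a , dj , eq) })
                , (λ { (inj₁ b) → inj₁ b
                     ; (inj₂ (j , a′ , dj , eq)) → [ (λ a → inj₂ (j , a , dj , eq)) , (λ { refl → ⊥-elim (¬d dj) }) ]′ (split j a′) })

module Construction (m : ℕ) (Γ : Digraph (suc (m + m))) (orient : IsOrientationOfPath Γ) (alt : IsAlternating Γ) where
  open Positions m Γ orient alt

  Covering : ℕ → List ℕ → Set
  Covering t cs = ∀ j → SinkNumber j → ∃ λ c → c ∈ₗ cs × c ≤ j + t × j ≤ c + t

  -- The construction, given a radius t and a list of centres (sink numbers
  -- up to m + ε, possibly virtual ones just off the path) such that every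
  -- sink is within distance t of a centre: B consists of all sources and the
  -- centre sinks; every other sink is forced from the side of a centre.
  module Strategy (t : ℕ) (cs : List ℕ)
                  (centre-≤ : ∀ c → c ∈ₗ cs → c ≤ m + ε)
                  (covered : Covering t cs) where

    Centre : ℕ → Set
    Centre j = j ∈ₗ cs

    -- A non-centre sink with a centre to its left within distance t is
    -- forced from the left; every other non-centre sink from the right.
    RightOfCentre : ℕ → Set
    RightOfCentre j = ¬ Centre j × ∃ λ c → c ∈ₗ cs × c < j × j ≤ c + t

    LeftOfCentre : ℕ → Set
    LeftOfCentre j = ¬ Centre j × ¬ RightOfCentre j

    RightOfCentre? : ∀ j → Dec (RightOfCentre j)
    RightOfCentre? j = ¬? (j ∈? cs) ×-dec map′ find (λ (c , c∈ , p) → lose c∈ p)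
                                            (any? (λ c → (c <? j) ×-dec (j ≤? c + t)) cs)

    LeftOfCentre? : ∀ j → Dec (LeftOfCentre j)
    LeftOfCentre? j = ¬? (j ∈? cs) ×-dec ¬? (RightOfCentre? j)

    right-of-centre-previous : ∀ {j} → RightOfCentre (suc j) → Centre j ⊎ RightOfCentre j
    right-of-centre-previous {j} (_ , c , c∈ , c<j+1 , j+1≤) with j ∈? cs
    ... | yes j∈ = inj₁ j∈
    ... | no j∉ with m≤n⇒m<n∨m≡n (s≤s⁻¹ c<j+1)
    ...   | inj₁ c<j = inj₂ (j∉ , c , c∈ , c<j , ≤-trans (n≤1+n j) j+1≤)
    ...   | inj₂ refl = ⊥-elim (j∉ c∈)

    left-of-centre-next : ∀ {j} → LeftOfCentre j → Centre (suc j) ⊎ LeftOfCentre (suc j)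
    left-of-centre-next {j} (j∉ , not-right) with suc j ∈? cs
    ... | yes j+1∈ = inj₁ j+1∈
    ... | no j+1∉ = inj₂ (j+1∉ , λ right → [ j∉ , not-right ]′ (right-of-centre-previous right))

    centre-to-the-right : ∀ {j} → SinkNumber j → LeftOfCentre j → ∃ λ c → c ∈ₗ cs × j < c × c ≤ j + t
    centre-to-the-right {j} sj (j∉ , not-right) with covered j sj
    ... | c , c∈ , c≤ , j≤ with <-cmp c j
    ...   | tri< c<j _ _ = ⊥-elim (not-right (j∉ , c , c∈ , c<j , j≤))
    ...   | tri≈ _ refl _ = ⊥-elim (j∉ c∈)
    ...   | tri> _ _ j<c = c , c∈ , j<c , c≤

    initiallyBlue : ℕ → Bool
    initiallyBlue w = isOdd w ∨ does (⌊ w /2⌋ ∈? cs)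

    B : Subset n
    B = tabulate (λ v → initiallyBlue (pos v))

    ∈B⇒ : ∀ {v} → v ∈ B → initiallyBlue (pos v) ≡ true
    ∈B⇒ {v} v∈ = trans (sym (lookup∘tabulate (λ v → initiallyBlue (pos v)) v)) ([]=⇒lookup v∈)

    ⇒∈B : ∀ {v} → initiallyBlue (pos v) ≡ true → v ∈ B
    ⇒∈B {v} blue = lookup⇒[]= v B (trans (lookup∘tabulate (λ v → initiallyBlue (pos v)) v) blue)

    blue-sink : ∀ j → initiallyBlue (j + j) ≡ does (j ∈? cs)
    blue-sink j rewrite odd-double j = cong (λ k → does (k ∈? cs)) (sym (n≡⌊n+n/2⌋ j))

    source∈B : ∀ {v} → isSource v ≡ true → v ∈ B
    source∈B {v} source = ⇒∈B (cong (_∨ does (⌊ pos v /2⌋ ∈? cs)) source)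

    centre∈B : ∀ {v j} → pos v ≡ j + j → Centre j → v ∈ B
    centre∈B {v} {j} pos-v j∈ = ⇒∈B (subst (λ w → initiallyBlue w ≡ true) (sym pos-v) (trans (blue-sink j) (dec-true (j ∈? cs) j∈)))

    non-centre∉B : ∀ {v j} → pos v ≡ j + j → ¬ Centre j → v ∉ B
    non-centre∉B {v} {j} pos-v j∉ v∈ with () ← trans (sym (dec-false (j ∈? cs) j∉)) (trans (sym (blue-sink j)) (subst (λ w → initiallyBlue w ≡ true) pos-v (∈B⇒ v∈)))

    FromLeft FromRight : ℕ → Set
    FromLeft j = SinkNumber j × RightOfCentre j
    FromRight j = SinkNumber j × LeftOfCentre j

    leftSource rightSource : ℕ → Fin n
    leftSource j = vertexAt (pred (j + j))
    rightSource j = vertexAt (suc (j + j))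

    pos-leftSource : ∀ {j} → SinkNumber (suc j) → pos (leftSource (suc j)) ≡ suc (j + j)
    pos-leftSource {j} (_ , ≤last) =
      trans (pos-vertexAt (≤-trans ε≤1 (subst (1 ≤_) (sym (+-suc j j)) (s≤s z≤n))) (≤-trans (n≤1+n _) ≤last)) (+-suc j j)

    pos-rightSource : ∀ {j} → FromRight j → pos (rightSource j) ≡ suc (j + j)
    pos-rightSource {j} (sj , left) with c , c∈ , j<c , _ ← centre-to-the-right sj left =
      pos-vertexAt (≤-trans ε≤1 (s≤s z≤n)) (in-path start-cases)
      where
      j<m+ε : j < m + ε
      j<m+ε = ≤-trans j<c (centre-≤ c c∈)
      in-path : (firstArc Γ ≡ false × ε ≡ 0) ⊎ (firstArc Γ ≡ true × ε ≡ 1) → suc (j + j) ≤ m + m + ε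
      in-path (inj₁ (_ , ε≡0)) = ≤-trans (+-mono-≤ j<m (<⇒≤ j<m)) (m≤m+n (m + m) ε)
        where
        j<m : j < m
        j<m = subst (j <_) (trans (cong (m +_) ε≡0) (+-identityʳ m)) j<m+ε
      in-path (inj₂ (_ , ε≡1)) = subst (suc (j + j) ≤_) (trans (+-comm 1 (m + m)) (cong (m + m +_) (sym ε≡1))) (s≤s (+-mono-≤ j≤m j≤m))
        where
        j≤m : j ≤ m
        j≤m = s≤s⁻¹ (subst (j <_) (trans (cong (m +_) ε≡1) (+-comm m 1)) j<m+ε)

    -- The blue sets while forcing from the left (sinks numbered below J
    -- done), and then from the right (sinks numbered J or more done).
    open Performing Γ

    BlueR : ℕ → Pred
    BlueR J = Accumulated (_∈ B) (_< J) FromLeft sinkAt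

    BlueL : ℕ → Pred
    BlueL J = Accumulated (BlueR (suc m)) (J ≤_) FromRight sinkAt

    leftSource-source : ∀ {j} → SinkNumber (suc j) → isSource (leftSource (suc j)) ≡ true
    leftSource-source {j} sj = trans (cong isOdd (pos-leftSource sj)) (odd-suc-double j)

    leftSource-arc : ∀ {j} → SinkNumber (suc j) → Γ (leftSource (suc j)) (sinkAt (suc j)) ≡ true
    leftSource-arc {j} sj = source-pos-arc (leftSource-source sj)
      (inj₁ (trans (cong suc (pos-leftSource sj)) (trans (cong suc (sym (+-suc j j))) (sym (pos-sinkAt {suc j} sj)))))

    leftSource-other : ∀ {j x} → SinkNumber (suc j) → Γ (leftSource (suc j)) x ≡ true → x ≡ sinkAt (suc j) ⊎ pos x ≡ j + j
    leftSource-other {j} sj ux with out-neighbours (pos-leftSource sj) ux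
    ... | inj₁ pos-x = inj₂ pos-x
    ... | inj₂ pos-x = inj₁ (sinkAt-pos {j = suc j} pos-x)

    rightSource-source : ∀ {j} → FromRight j → isSource (rightSource j) ≡ true
    rightSource-source {j} fr = trans (cong isOdd (pos-rightSource fr)) (odd-suc-double j)

    rightSource-arc : ∀ {j} → FromRight j → Γ (rightSource j) (sinkAt j) ≡ true
    rightSource-arc {j} fr = source-pos-arc (rightSource-source fr)
      (inj₂ (trans (cong suc (pos-sinkAt {j} (proj₁ fr))) (sym (pos-rightSource fr))))

    rightSource-other : ∀ {j x} → FromRight j → Γ (rightSource j) x ≡ true → x ≡ sinkAt j ⊎ pos x ≡ suc j + suc j
    rightSource-other {j} fr ux with out-neighbours (pos-rightSource fr) ux
    ... | inj₁ pos-x = inj₁ (sinkAt-pos {j = j} pos-x)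
    ... | inj₂ pos-x = inj₂ pos-x

    -- Forcing sink J from the left is valid once the sinks before it are
    -- done: its other neighbour, sink J − 1, is a centre or was forced before.
    valid-from-left : ∀ J → FromLeft J → ForceOK (BlueR J) (leftSource J) (sinkAt J)
    valid-from-left zero (_ , _ , _ , _ , () , _)
    valid-from-left (suc j) (sj , right) = inj₁ (source∈B (leftSource-source sj)) , not-yet , leftSource-arc sj , others
      where
      not-yet : ¬ BlueR (suc j) (sinkAt (suc j))
      not-yet (inj₁ w∈B) = non-centre∉B (pos-sinkAt {suc j} sj) (proj₁ right) w∈B
      not-yet (inj₂ (j′ , j′<j+1 , (sj′ , _) , eq)) = <-irrefl (sym (sinkAt-injective {suc j} {j′} sj sj′ eq)) j′<j+1
      others : ∀ x → Γ (leftSource (suc j)) x ≡ true → ¬ BlueR (suc j) x → x ≡ sinkAt (suc j)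
      others x ux x∉ with leftSource-other sj ux
      ... | inj₁ x≡w = x≡w
      ... | inj₂ pos-x with right-of-centre-previous right
      ...   | inj₁ j∈ = ⊥-elim (x∉ (inj₁ (centre∈B {j = j} pos-x j∈)))
      ...   | inj₂ right′ = ⊥-elim (x∉ (inj₂ (j , ≤-refl , (sink-number {j = j} pos-x , right′) , sinkAt-pos {j = j} pos-x)))

    -- Forcing sink j from the right is valid once the sinks after it that are
    -- forced from the right are done: its other neighbour, sink j + 1, is a
    -- centre or was forced before.
    valid-from-right : ∀ j → FromRight j → ForceOK (BlueL (suc j)) (rightSource j) (sinkAt j)
    valid-from-right j (sj , left) = inj₁ (inj₁ (source∈B (rightSource-source (sj , left)))) , not-yet , rightSource-arc (sj , left) , others
      where
      not-yet : ¬ BlueL (suc j) (sinkAt j)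
      not-yet (inj₁ (inj₁ w∈B)) = non-centre∉B (pos-sinkAt {j} sj) (proj₁ left) w∈B
      not-yet (inj₁ (inj₂ (j′ , _ , (sj′ , right) , eq))) = proj₂ left (subst RightOfCentre (sym (sinkAt-injective {j} {j′} sj sj′ eq)) right)
      not-yet (inj₂ (j′ , j+1≤j′ , (sj′ , _) , eq)) = <-irrefl (sinkAt-injective {j} {j′} sj sj′ eq) j+1≤j′
      others : ∀ x → Γ (rightSource j) x ≡ true → ¬ BlueL (suc j) x → x ≡ sinkAt j
      others x ux x∉ with rightSource-other (sj , left) ux
      ... | inj₁ x≡w = x≡w
      ... | inj₂ pos-x with left-of-centre-next left
      ...   | inj₁ j+1∈ = ⊥-elim (x∉ (inj₁ (inj₁ (centre∈B {j = suc j} pos-x j+1∈))))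
      ...   | inj₂ left′ = ⊥-elim (x∉ (inj₂ (suc j , ≤-refl , (sink-number {j = suc j} pos-x , left′) , sinkAt-pos {j = suc j} pos-x)))

    FromLeft? : ∀ j → Dec (FromLeft j)
    FromLeft? j = SinkNumber? j ×-dec RightOfCentre? j

    FromRight? : ∀ j → Dec (FromRight j)
    FromRight? j = SinkNumber? j ×-dec LeftOfCentre? j

    -- The forces: sinks from the left in increasing order of their numbers,
    -- then sinks from the right in decreasing order.
    forcesFromLeft : ℕ → List (Force n)
    forcesFromLeft zero = []
    forcesFromLeft (suc J) = forcesFromLeft J ++ optional (FromLeft? J) (leftSource J , sinkAt J)

    forcesFromRight : ℕ → List (Force n)
    forcesFromRight zero = []
    forcesFromRight (suc J) = optional (FromRight? J) (rightSource J , sinkAt J) ++ forcesFromRight J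

    F : List (Force n)
    F = forcesFromLeft (suc m) ++ forcesFromRight (suc m)

    phase-left : ∀ J → Performs (BlueR 0) (forcesFromLeft J) (BlueR J)
    phase-left zero = none ≐-refl
    phase-left (suc J) =
      performs-++ (phase-left J) (perform-optional J (FromLeft? J) (λ _ → m<n⇒m<1+n) (λ _ → m<1+n⇒m<n∨m≡n) ≤-refl (valid-from-left J))

    phase-right : ∀ J → Performs (BlueL J) (forcesFromRight J) (BlueL 0)
    phase-right zero = none ≐-refl
    phase-right (suc J) =
      performs-++ (perform-optional J (FromRight? J) (λ _ → <⇒≤) (λ _ J≤j → [ inj₁ , (λ eq → inj₂ (sym eq)) ]′ (m≤n⇒m<n∨m≡n J≤j)) ≤-refl (valid-from-right J))
                  (phase-right J)

    -- Between the phases nothing changes: sink numbers stay below m + 1.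
    switch : BlueR (suc m) ≐ BlueL (suc m)
    switch x = inj₁ , λ { (inj₁ blue) → blue ; (inj₂ (j , m<j , (sj , _) , _)) → ⊥-elim (<⇒≱ m<j (sink-number-≤ sj)) }

    everything-blue : ∀ x → BlueL 0 x
    everything-blue x with isSource x in source
    ... | true = inj₁ (inj₁ (source∈B source))
    ... | false with halve (pos x) source
    ...   | j , pos-x with j ∈? cs | RightOfCentre? j
    ...     | yes j∈ | _ = inj₁ (inj₁ (centre∈B {j = j} pos-x j∈))
    ...     | no _ | yes right = inj₁ (inj₂ (j , s≤s (sink-number-≤ sj) , (sj , right) , sinkAt-pos {j = j} pos-x))
      where sj = sink-number {j = j} pos-x
    ...     | no j∉ | no not-right = inj₂ (j , z≤n , (sink-number {j = j} pos-x , j∉ , not-right) , sinkAt-pos {j = j} pos-x)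

    run : Run Γ B F
    run = performs-run B (λ _ → inj₁) initially
            (performs-++ (phase-left (suc m)) (performs-cong switch (phase-right (suc m)))) everything-blue
      where
      initially : ∀ x → BlueR 0 x → x ∈ B
      initially x (inj₁ x∈B) = x∈B

    listed-from-left : ∀ {j} → FromLeft j → (leftSource j , sinkAt j) ∈ₗ F
    listed-from-left {j} fl = ∈-++⁺ˡ (listed (suc m) (s≤s (sink-number-≤ (proj₁ fl))))
      where
      listed : ∀ J → j < J → (leftSource j , sinkAt j) ∈ₗ forcesFromLeft J
      listed (suc J) j<J+1 with m<1+n⇒m<n∨m≡n j<J+1
      ... | inj₁ j<J = ∈-++⁺ˡ (listed J j<J)
      ... | inj₂ refl = ∈-++⁺ʳ (forcesFromLeft J) (optional-∈ (FromLeft? j) _ fl)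

    listed-from-right : ∀ {j} → FromRight j → (rightSource j , sinkAt j) ∈ₗ F
    listed-from-right {j} fr = ∈-++⁺ʳ (forcesFromLeft (suc m)) (listed (suc m) (s≤s (sink-number-≤ (proj₁ fr))))
      where
      listed : ∀ J → j < J → (rightSource j , sinkAt j) ∈ₗ forcesFromRight J
      listed (suc J) j<J+1 with m<1+n⇒m<n∨m≡n j<J+1
      ... | inj₁ j<J = ∈-++⁺ʳ (optional (FromRight? J) _) (listed J j<J)
      ... | inj₂ refl = ∈-++⁺ˡ (optional-∈ (FromRight? j) _ fr)

    open Stages Γ B F

    stage-from-left : ∀ d j → SinkNumber j → Centre j ⊎ RightOfCentre j →
                      ∀ c → c ∈ₗ cs → c ≤ j → j ≤ c + d → Stage d (sinkAt j)
    stage-from-left d j sj (inj₁ j∈) c c∈ _ _ = initial (centre∈B (pos-sinkAt {j} sj) j∈)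
    stage-from-left zero j sj (inj₂ right) c c∈ c≤j j≤c+0 =
      ⊥-elim (proj₁ right (subst Centre (≤-antisym c≤j (subst (j ≤_) (+-identityʳ c) j≤c+0)) c∈))
    stage-from-left (suc d) zero sj (inj₂ (_ , _ , _ , () , _)) c c∈ c≤j j≤c+d
    stage-from-left (suc d) (suc j) sj (inj₂ right) c c∈ c≤j j≤c+d =
      force-step (initial (source∈B (leftSource-source sj))) (listed-from-left (sj , right)) (leftSource-arc sj) others
      where
      c<j+1 : c < suc j
      c<j+1 with m≤n⇒m<n∨m≡n c≤j
      ... | inj₁ c<j+1 = c<j+1
      ... | inj₂ refl = ⊥-elim (proj₁ right c∈)
      others : OthersBlue d (leftSource (suc j)) (sinkAt (suc j))
      others x ux with leftSource-other sj ux
      ... | inj₁ x≡w = inj₁ x≡w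
      ... | inj₂ pos-x = inj₂ (subst (Stage d) (sym (sinkAt-pos {j = j} pos-x))
          (stage-from-left d j (sink-number {j = j} pos-x) (right-of-centre-previous right) c c∈ (s≤s⁻¹ c<j+1)
                           (s≤s⁻¹ (≤-trans j≤c+d (≤-reflexive (+-suc c d))))))

    stage-from-right : ∀ d j → SinkNumber j → Centre j ⊎ LeftOfCentre j →
                       ∀ c → c ∈ₗ cs → j ≤ c → c ≤ j + d → Stage d (sinkAt j)
    stage-from-right d j sj (inj₁ j∈) c c∈ _ _ = initial (centre∈B (pos-sinkAt {j} sj) j∈)
    stage-from-right zero j sj (inj₂ left) c c∈ j≤c c≤j+0 =
      ⊥-elim (proj₁ left (subst Centre (≤-antisym (subst (c ≤_) (+-identityʳ j) c≤j+0) j≤c) c∈))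
    stage-from-right (suc d) j sj (inj₂ left) c c∈ j≤c c≤j+d =
      force-step (initial (source∈B (rightSource-source (sj , left)))) (listed-from-right (sj , left)) (rightSource-arc (sj , left)) others
      where
      j<c : j < c
      j<c with m≤n⇒m<n∨m≡n j≤c
      ... | inj₁ j<c = j<c
      ... | inj₂ refl = ⊥-elim (proj₁ left c∈)
      others : OthersBlue d (rightSource j) (sinkAt j)
      others x ux with rightSource-other (sj , left) ux
      ... | inj₁ x≡w = inj₁ x≡w
      ... | inj₂ pos-x = inj₂ (subst (Stage d) (sym (sinkAt-pos {j = suc j} pos-x))
          (stage-from-right d (suc j) (sink-number {j = suc j} pos-x) (left-of-centre-next left) c c∈ j<c
                            (≤-trans c≤j+d (≤-reflexive (+-suc j d)))))

    complete : StageFull Γ B F t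
    complete x with isSource x in source
    ... | true = initial (source∈B source)
    ... | false with halve (pos x) source
    ...   | j , pos-x rewrite sinkAt-pos {j = j} pos-x with j ∈? cs | RightOfCentre? j
    ...     | yes j∈ | _ = initial (centre∈B (pos-sinkAt {j} sj) j∈)
      where sj = sink-number {j = j} pos-x
    ...     | no _ | yes right@(_ , c , c∈ , c<j , j≤c+t) = stage-from-left t j sj (inj₂ right) c c∈ (<⇒≤ c<j) j≤c+t
      where sj = sink-number {j = j} pos-x
    ...     | no j∉ | no not-right with centre-to-the-right sj (j∉ , not-right)
      where sj = sink-number {j = j} pos-x
    ...       | c , c∈ , j<c , c≤j+t = stage-from-right t j (sink-number {j = j} pos-x) (inj₂ (j∉ , not-right)) c c∈ (<⇒≤ j<c) c≤j+t

    marks-B : ∀ {p} → p < n → marks B p ≡ initiallyBlue (p + ε)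
    marks-B {p} p<n = marks-tabulate (λ q → initiallyBlue (q + ε)) p p<n

    size-sink-start : ε ≡ 0 → ∣ B ∣ ≤ m + count (λ j → does (j ∈? cs)) (suc m)
    size-sink-start ε≡0 = begin
      ∣ B ∣                                                     ≡⟨ size-even-odd m B ⟩
      count (λ j → marks B (j + j)) (suc m) + odds              ≡⟨ cong (_+ odds) (count-cong (suc m) centres) ⟩
      count (λ j → does (j ∈? cs)) (suc m) + odds               ≤⟨ +-monoʳ-≤ _ odds≤m ⟩
      count (λ j → does (j ∈? cs)) (suc m) + m                  ≡⟨ +-comm _ m ⟩
      m + count (λ j → does (j ∈? cs)) (suc m)                  ∎
      where
      open ≤-Reasoning
      odds = count (λ j → marks B (suc (j + j))) (suc m)
      odds≤m : odds ≤ m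
      odds≤m = ≤-trans (≤-reflexive (odd-indices m B)) (count-≤ _ m)
      centres : ∀ j → j < suc m → marks B (j + j) ≡ does (j ∈? cs)
      centres j j≤m = trans (marks-B (s≤s (+-mono-≤ (s≤s⁻¹ j≤m) (s≤s⁻¹ j≤m))))
                            (trans (cong initiallyBlue (trans (cong (j + j +_) ε≡0) (+-identityʳ _))) (blue-sink j))

    size-source-start : ε ≡ 1 → ∣ B ∣ ≤ suc m + count (λ i → does (suc i ∈? cs)) m
    size-source-start ε≡1 = begin
      ∣ B ∣                                                     ≡⟨ size-even-odd m B ⟩
      count (λ j → marks B (j + j)) (suc m) + odds              ≤⟨ +-monoˡ-≤ odds (count-≤ _ (suc m)) ⟩
      suc m + odds                                              ≡⟨ cong (suc m +_) (trans (odd-indices m B) (count-cong m centres)) ⟩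
      suc m + count (λ i → does (suc i ∈? cs)) m                ∎
      where
      open ≤-Reasoning
      odds = count (λ j → marks B (suc (j + j))) (suc m)
      centres : ∀ i → i < m → marks B (suc (i + i)) ≡ does (suc i ∈? cs)
      centres i i<m = trans (marks-B (s≤s (+-mono-≤ i<m (<⇒≤ i<m))))
                            (trans (cong initiallyBlue (trans (cong (suc (i + i) +_) ε≡1) (+-comm (suc (i + i)) 1))) (trans (cong (λ k → initiallyBlue (suc k)) (sym (+-suc i i))) (blue-sink (suc i))))

  Achieves : ℕ → Set
  Achieves c = Σ (Subset n) λ B → Σ (List (Force n)) λ F → Σ ℕ λ t → Completes Γ B F t × ∣ B ∣ + t ≤ c

  -- When vertex 0 is a sink: the b centres (2t + 1)r + t, capped at m,
  -- r < b, cover the sinks 0, …, m whenever m + 1 ≤ (2t + 1)b.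
  sinkStartCentre : ℕ → ℕ → ℕ
  sinkStartCentre t r = ((2 * t + 1) * r + t) ⊓ m

  sink-start-covering : ∀ b t → suc m ≤ (2 * t + 1) * b → Covering t (applyUpTo (sinkStartCentre t) b)
  sink-start-covering b t room j sj
    with r , r<b , Dr≤j , j<Dr+D ← block-of (2 * t + 1) b j (≤-trans (s≤s (sink-number-≤ sj)) room) =
    sinkStartCentre t r , ∈-applyUpTo⁺ (sinkStartCentre t) r<b , ≤-trans (m⊓n≤m _ m) (+-monoˡ-≤ t Dr≤j) , reach
    where
    reach : j ≤ sinkStartCentre t r + t
    reach with (2 * t + 1) * r + t ≤? m
    ... | yes ≤m = subst (λ c → j ≤ c + t) (sym (m≤n⇒m⊓n≡m ≤m)) (s≤s⁻¹ (≤-trans j<Dr+D (≤-reflexive (regroup ((2 * t + 1) * r) t))))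
      where
      regroup : ∀ x t → x + (2 * t + 1) ≡ suc (x + t + t)
      regroup = solve-∀
    ... | no ≰m = subst (λ c → j ≤ c + t) (sym (m≥n⇒m⊓n≡n (<⇒≤ (≰⇒> ≰m)))) (≤-trans (sink-number-≤ sj) (m≤m+n m t))

  sink-start-strategy : ε ≡ 0 → ∀ b t → suc m ≤ (2 * t + 1) * b → Achieves (m + (b + t))
  sink-start-strategy ε≡0 b t room = S.B , S.F , t , (S.run , S.complete) , cost
    where
    cs = applyUpTo (sinkStartCentre t) b
    centre-≤ : ∀ c → c ∈ₗ cs → c ≤ m + ε
    centre-≤ c c∈ with r , _ , refl ← ∈-applyUpTo⁻ (sinkStartCentre t) c∈ = ≤-trans (m⊓n≤n _ m) (m≤m+n m ε)
    module S = Strategy t cs centre-≤ (sink-start-covering b t room)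
    cost : ∣ S.B ∣ + t ≤ m + (b + t)
    cost = begin
      ∣ S.B ∣ + t                                      ≤⟨ +-monoˡ-≤ t (S.size-sink-start ε≡0) ⟩
      m + count (λ j → does (j ∈? cs)) (suc m) + t     ≤⟨ +-monoˡ-≤ t (+-monoʳ-≤ m (count-members (λ i → i) (λ _ _ eq → eq) cs (suc m))) ⟩
      m + length cs + t                                ≡⟨ cong (λ l → m + l + t) (length-applyUpTo (sinkStartCentre t) b) ⟩
      m + b + t                                        ≡⟨ +-assoc m b t ⟩
      m + (b + t)                                      ∎
      where open ≤-Reasoning

  -- When vertex 0 is a source: the virtual centres 0 and m + 1 cover t sinks
  -- at either end, and the b − 1 inner centres (2t + 1)(r + 1), capped at
  -- m + 1, r < b − 1, cover the rest whenever m + 1 ≤ (2t + 1)b.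
  innerCentre : ℕ → ℕ → ℕ
  innerCentre t r = ((2 * t + 1) * suc r) ⊓ suc m

  sourceStartCentres : ℕ → ℕ → List ℕ
  sourceStartCentres b t = 0 ∷ suc m ∷ applyUpTo (innerCentre t) (b ∸ 1)

  source-start-covering : ∀ b t → suc m ≤ (2 * t + 1) * b → Covering t (sourceStartCentres b t)
  source-start-covering b t room j sj with j ≤? t | suc m ≤? j + t
  ... | yes j≤t | _ = 0 , here refl , z≤n , j≤t
  ... | no _ | yes m<j+t = suc m , there (here refl) , m<j+t , ≤-trans (sink-number-≤ sj) (≤-trans (n≤1+n m) (m≤m+n (suc m) t))
  ... | no j≰t | no m≮j+t with block-of (2 * t + 1) b (j + t) (≤-trans (≰⇒> m≮j+t) room)
  ...   | zero , _ , _ , j+t<D = ⊥-elim (j≰t (s≤s⁻¹ (+-cancelʳ-≤ t (suc j) (suc t) (≤-trans j+t<D (≤-reflexive (first-block t))))))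
    where
    first-block : ∀ t → (2 * t + 1) * 0 + (2 * t + 1) ≡ suc t + t
    first-block = solve-∀
  ...   | suc r , r+1<b , D[r+1]≤ , <D[r+1]+D =
    innerCentre t r , there (there (∈-applyUpTo⁺ (innerCentre t) (∸-monoˡ-< r+1<b (s≤s z≤n)))) ,
    subst (_≤ j + t) (sym exact) D[r+1]≤ ,
    subst (λ c → j ≤ c + t) (sym exact) (+-cancelʳ-≤ t j _ (s≤s⁻¹ (≤-trans <D[r+1]+D (≤-reflexive (regroup ((2 * t + 1) * suc r) t)))))
    where
    exact : innerCentre t r ≡ (2 * t + 1) * suc r
    exact = m≤n⇒m⊓n≡m (≤-trans D[r+1]≤ (<⇒≤ (≰⇒> m≮j+t)))
    regroup : ∀ x t → x + (2 * t + 1) ≡ suc (x + t + t)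
    regroup = solve-∀

  source-start-strategy : ε ≡ 1 → ∀ b t → suc m ≤ (2 * t + 1) * b → Achieves (m + (b + t))
  source-start-strategy ε≡1 b t room = S.B , S.F , t , (S.run , S.complete) , cost
    where
    inners = applyUpTo (innerCentre t) (b ∸ 1)
    cs = sourceStartCentres b t
    m+ε≡ : m + ε ≡ suc m
    m+ε≡ = trans (cong (m +_) ε≡1) (+-comm m 1)
    centre-≤ : ∀ c → c ∈ₗ cs → c ≤ m + ε
    centre-≤ c (here refl) = z≤n
    centre-≤ c (there (here refl)) = ≤-reflexive (sym m+ε≡)
    centre-≤ c (there (there c∈)) with r , _ , refl ← ∈-applyUpTo⁻ (innerCentre t) c∈ =
      subst (innerCentre t r ≤_) (sym m+ε≡) (m⊓n≤n _ (suc m))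
    module S = Strategy t cs centre-≤ (source-start-covering b t room)
    only-inner : ∀ i → i < m → does (suc i ∈? cs) ≡ true → does (suc i ∈? inners) ≡ true
    only-inner i i<m i+1∈ with from-does (suc i ∈? cs) i+1∈
    ... | there (here i+1≡m+1) = ⊥-elim (<-irrefl (suc-injective i+1≡m+1) i<m)
    ... | there (there i+1∈inners) = dec-true (suc i ∈? inners) i+1∈inners
    cost : ∣ S.B ∣ + t ≤ m + (b + t)
    cost = begin
      ∣ S.B ∣ + t                                           ≤⟨ +-monoˡ-≤ t (S.size-source-start ε≡1) ⟩
      suc m + count (λ i → does (suc i ∈? cs)) m + t        ≤⟨ +-monoˡ-≤ t (+-monoʳ-≤ (suc m) (count-mono m only-inner)) ⟩
      suc m + count (λ i → does (suc i ∈? inners)) m + t    ≤⟨ +-monoˡ-≤ t (+-monoʳ-≤ (suc m) (count-members suc (λ _ _ → suc-injective) inners m)) ⟩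
      suc m + length inners + t                             ≡⟨ cong (λ l → suc m + l + t) (length-applyUpTo (innerCentre t) (b ∸ 1)) ⟩
      suc m + (b ∸ 1) + t                                   ≡⟨ cong (_+ t) (trans (sym (+-suc m (b ∸ 1))) (cong (m +_) b-1+1≡b)) ⟩
      m + b + t                                             ≡⟨ +-assoc m b t ⟩
      m + (b + t)                                           ∎
      where
      open ≤-Reasoning
      b-1+1≡b : suc (b ∸ 1) ≡ b
      b-1+1≡b = trans (+-comm 1 (b ∸ 1)) (m∸n+n≡m (positive-factor {D = 2 * t + 1} room))

  upper-bound : ∀ k → 4 * (suc (m + m) + 1) ≤ (2 * k + 1) * (2 * k + 1) → Achieves (m + k)
  upper-bound k large with b , t , refl , room ← budget-upper m k (subst (_≤ (2 * k + 1) * (2 * k + 1)) (four-n+1 m) large)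
                       | start-cases
  ... | inj₁ (_ , ε≡0) = sink-start-strategy ε≡0 b t room
  ... | inj₂ (_ , ε≡1) = source-start-strategy ε≡1 b t room

throttling-number : ∀ m (Γ : Digraph (suc (m + m))) → IsOrientationOfPath Γ → IsAlternating Γ →
                    ∀ k → IsCeilSqrtTerm (suc (m + m)) k → IsThrottlingNumber Γ (m + k)
throttling-number m Γ orient alt k (small , large)
  with B , F , t , completes , cost ← Construction.upper-bound m Γ orient alt k large =
  (B , F , t , completes , ≤-antisym cost (lower B F t completes)) , lower
  where
  lower : ∀ B F t → Completes Γ B F t → m + k ≤ ∣ B ∣ + t
  lower B F t completes = LowerBound.lower-bound m Γ orient alt B F k small t (proj₂ completes)

odd-form : ∀ n → n % 2 ≡ 1 → n ≡ suc (n / 2 + n / 2)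
odd-form n n-odd = trans (m≡m%n+[m/n]*n n 2) (trans (cong (_+ (n / 2) * 2) n-odd) (double (n / 2)))
  where
  double : ∀ x → 1 + x * 2 ≡ suc (x + x)
  double = solve-∀

half-of-double : ∀ m → (m + m) / 2 ≡ m
half-of-double m = trans (cong (_/ 2) (double m)) (m*n/n≡m m 2)
  where
  double : ∀ m → m + m ≡ m * 2
  double = solve-∀

proposition4p3 : (n : ℕ) → n % 2 ≡ 1 → (Γ : Digraph n) → IsOrientationOfPath Γ → IsAlternating Γ →
    (k : ℕ) → IsCeilSqrtTerm n k → IsThrottlingNumber Γ ((n ∸ 1) / 2 + k)
proposition4p3 n n-odd = for-odd n (n / 2) (odd-form n n-odd)
  where
  for-odd : ∀ n m → n ≡ suc (m + m) → (Γ : Digraph n) → IsOrientationOfPath Γ → IsAlternating Γ →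
            (k : ℕ) → IsCeilSqrtTerm n k → IsThrottlingNumber Γ ((n ∸ 1) / 2 + k)
  for-odd .(suc (m + m)) m refl Γ orient alt k ceil =
    subst (λ h → IsThrottlingNumber Γ (h + k)) (sym (half-of-double m)) (throttling-number m Γ orient alt k ceil)
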